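{- Let $\mathcal{M}=\mathcal{M}(\Sigma,I)$ be a trace monoid acting partially on a finite set $X_0$, with associated total action on $X_0\cup\{\bot\}$. Define the square matrices indexed by $X_0\times X_0$ with entries in $\mathbb{Z}[[t]]$: $Z_{\alpha,\beta}(t)=\sum_{x\in\mathcal{M}_{\alpha,\beta}}t^{|x|}$ and $\mu_{\alpha,\beta}(t)=\sum_{\gamma\in\mathscr{C}\cap\mathcal{M}_{\alpha,\beta}}(-1)^{|\gamma|}t^{|\gamma|}$. Then $\mu(t)Z(t)=Z(t)\mu(t)=I$ in the algebra of $X_0\times X_0$ matrices over $\mathbb{Z}[[t]]$, where $I_{\alpha,\beta}=\mathbf{1}_{\{\alpha=\beta\}}$.
   Context: Trace monoid: $\Sigma$ finite, $|\Sigma|\ge2$, $I$ irreflexive symmetric relation on $\Sigma$, $\mathcal{M}=\Sigma^*/\langle ab=ba,\ (a,b)\in I\rangle$, unit $1$, length $|x|$. Cliques: traces $a_1\cdots a_k$ ($k\ge0$) of pairwise distinct letters pairwise in $I$; $\mathscr{C}$ the set of cliques; $c\parallel c'$ if $c\cdot c'$ is a clique. A partial action: nonempty $\Sigma(\alpha)\subseteq\Sigma$ for $\alpha\in X_0$ and maps $a\in\Sigma(\alpha)\mapsto\alpha\cdot a\in X_0$ such that if $a\in\Sigma(\alpha)$ and $a\parallel b$, then either $b\in\Sigma(\alpha)$ and $a\in\Sigma(\alpha\cdot b)$, $b\in\Sigma(\alpha\cdot a)$, $(\alpha\cdot a)\cdot b=(\alpha\cdot b)\cdot a$; or $b\notin\Sigma(\alpha)$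 and $b\notin\Sigma(\alpha\cdot a)$. The associated total action is the unique right action of $\mathcal{M}$ on $X_0\cup\{\bot\}$ extending these maps with $\alpha\cdot a=\bot$ for $a\notin\Sigma(\alpha)$ and $\bot\cdot a=\bot$. $\mathcal{M}_{\alpha,\beta}=\{x\in\mathcal{M}:\alpha\cdot x=\beta\}$ for $\alpha,\beta\in X_0$. -}

module Defs where

open import Data.Nat using (ℕ; zero; suc; _≤_; _∸_)
open import Data.Integer using (ℤ; +_; -_; _*_; _+_; 0ℤ; 1ℤ)
open import Data.Fin using (Fin; zero; suc)
open import Data.List using (List; []; _∷_; _++_; length; foldl)
open import Data.List.Relation.Unary.All using (All)
open import Data.List.Relation.Unary.Any using (Any)
open import Data.List.Relation.Unary.AllPairs using (AllPairs)
open import Data.Maybe using (Maybe; just; nothing)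
open import Data.Product using (Σ; _×_; ∃)
open import Data.Sum using (_⊎_)
open import Relation.Binary.PropositionalEquality using (_≡_; _≢_)
open import Relation.Nullary using (¬_; Dec; yes; no)

record IndepAlphabet : Set₁ where
  field
    s        : ℕ
    two≤s    : 2 ≤ s
    Ind      : Fin s → Fin s → Set
    Ind-dec  : ∀ a b → Dec (Ind a b)
    Ind-irr  : ∀ a → ¬ Ind a a
    Ind-sym  : ∀ a b → Ind a b → Ind b a

module _ (A : IndepAlphabet) where
  open IndepAlphabet A

  Letter : Set
  Letter = Fin s

  Word : Set
  Word = List Letter

  data _~_ : Word → Word → Set where
    ~-refl  : ∀ {u} → u ~ u
    ~-sym   : ∀ {u v} → u ~ v → v ~ u
    ~-trans : ∀ {u v w} → u ~ v → v ~ w → u ~ w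
    ~-swap  : ∀ u v {a b} → Ind a b →
              (u ++ a ∷ b ∷ v) ~ (u ++ b ∷ a ∷ v)

  IsClique : Word → Set
  IsClique w = AllPairs (λ a b → a ≢ b × Ind a b) w

  _∥_ : Letter → Letter → Set
  a ∥ b = a ≢ b × Ind a b

  -- Partial action of the trace monoid on X₀ = Fin m.
  -- step α a = just (α·a) if a ∈ Σ(α), nothing otherwise.
  record PartialAction (m : ℕ) : Set where
    field
      step     : Fin m → Letter → Maybe (Fin m)
      nonempty : ∀ α → ∃ λ a → step α a ≢ nothing
      coherent : ∀ α a b α' → step α a ≡ just α' → a ∥ b →
                 (Σ (Fin m) λ β → Σ (Fin m) λ γ →
                     step α b ≡ just β
                   × step α' b ≡ just γ
                   × step β a ≡ just γ)
                 ⊎ (step α b ≡ nothing × step α' b ≡ nothing)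

    -- associated total action on X₀ ∪ {⊥} (⊥ = nothing), on words
    stepT : Maybe (Fin m) → Letter → Maybe (Fin m)
    stepT nothing  a = nothing
    stepT (just α) a = step α a

    actT : Maybe (Fin m) → Word → Maybe (Fin m)
    actT = foldl stepT

  -- ClassCount P n k : the set of traces of length n whose representatives
  -- satisfy P (a ~-invariant predicate) has exactly k elements, witnessed
  -- by a list of k pairwise non-equivalent representatives covering all
  -- such traces.
  ClassCount : (Word → Set) → ℕ → ℕ → Set
  ClassCount P n k =
    Σ (List Word) λ L →
        length L ≡ k
      × All (λ w → length w ≡ n × P w) L
      × AllPairs (λ u v → ¬ (u ~ v)) L
      × (∀ w → length w ≡ n → P w → Any (λ u → w ~ u) L)

-- Formal power series over ℤ as coefficient sequences ℕ → ℤ;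
-- X₀ × X₀ matrices of power series as Fin m → Fin m → ℕ → ℤ.

sumFin : (m : ℕ) → (Fin m → ℤ) → ℤ
sumFin zero    f = 0ℤ
sumFin (suc m) f = f zero + sumFin m (λ i → f (suc i))

sumUpTo : ℕ → (ℕ → ℤ) → ℤ
sumUpTo zero    f = f zero
sumUpTo (suc n) f = sumUpTo n f + f (suc n)

PSMat : ℕ → Set
PSMat m = Fin m → Fin m → ℕ → ℤ

_⊛_ : ∀ {m} → PSMat m → PSMat m → PSMat m
(_⊛_ {m} A B) α β n =
  sumFin m λ γ → sumUpTo n λ k → A α γ k * B γ β (n ∸ k)

idPS : ∀ {m} → PSMat m
idPS α β zero with α Data.Fin.≟ β
... | yes _ = 1ℤ
... | no  _ = 0ℤ
idPS α β (suc n) = 0ℤ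

sign : ℕ → ℤ
sign zero    = 1ℤ
sign (suc n) = - sign n

-- Expanding the products, the degree-n coefficient of (μ Z)(α, β) is the alternating sum over k of
-- the number of pairs (c, x) where c is a clique of length k, x a trace of length n - k, and
-- α · c x = β; traces are represented by their lexicographic normal forms, so all counts are
-- counts of lists of words. Given such a pair, let a be the least letter that either occurs in c,
-- or begins x and commutes with every letter of c. Moving a from c to the front of x, or from x
-- into c, keeps a the least such letter and changes the length of c by one, so it is a
-- sign-reversing involution: the alternating sum vanishes for n > 0, and for n = 0 only the
-- empty pair remains, which counts 1 exactly when α = β. The identity Z μ = 1 is the same
-- computation after reversing words, which turns the pair (x, c) into (rev c, rev x).

module Submission where

open import Defs
open import Algebra using (CommutativeMonoid)
open import Data.Bool using (Bool; true; false; _∧_; _∨_; not; if_then_else_)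
open import Data.Bool.Properties
  using (∧-commutativeMonoid; ∨-commutativeMonoid; ∨-zeroʳ; ∨-identityʳ; ∧-zeroʳ; ∧-assoc; ¬-not; not-injective)
open import Data.Empty using (⊥-elim)
open import Data.Fin as Fin using (Fin; zero; suc)
import Data.Fin.Properties as Finₚ
open import Data.List
  using (List; []; _∷_; _++_; length; map; foldl; reverse; [_]; tabulate; allFin; cartesianProductWith; cartesianProduct)
import Data.List.Properties as Listₚ
open import Data.List.Relation.Unary.All as All using (All; []; _∷_)
import Data.List.Relation.Unary.All.Properties as Allₚ
open import Data.List.Relation.Unary.Any as Any using (Any; here; there)
open import Data.List.Relation.Unary.AllPairs using (AllPairs; []; _∷_)
open import Data.Maybe as Maybe using (Maybe; just; nothing)
import Data.Maybe.Properties as Maybeₚ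
open import Data.Nat using (ℕ; zero; suc; _+_; _*_; _∸_; _≤_; _<_; z≤n; s≤s)
import Data.Nat.Properties as ℕₚ
open import Data.Product using (Σ; _×_; _,_; proj₁; proj₂)
import Data.Product.Properties as Productₚ
open import Data.Sum using (_⊎_; inj₁; inj₂)
open import Data.Integer as ℤ using (ℤ)
import Data.Integer.Properties as ℤₚ
open import Data.Integer.Tactic.RingSolver using (solve-∀)
open import Function using (_∘_; id; case_of_)
open import Relation.Binary.Definitions using (DecidableEquality)
open import Relation.Binary.PropositionalEquality hiding ([_])
open import Relation.Nullary using (¬_; Dec; yes; no; does)
open import Relation.Nullary.Decidable using (dec-true; dec-false; does-⇔; _×-dec_)
open import Function.Bundles using (mk⇔; _⇔_; Equivalence)

open import Algebra.Properties.CommutativeSemigroup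
  (CommutativeMonoid.commutativeSemigroup ∧-commutativeMonoid)
  using () renaming (x∙yz≈y∙xz to ∧-swapˡ)
open import Algebra.Properties.CommutativeSemigroup
  (CommutativeMonoid.commutativeSemigroup ∨-commutativeMonoid)
  using () renaming (x∙yz≈y∙xz to ∨-swapˡ)
open import Algebra.Properties.CommutativeSemigroup ℕₚ.+-commutativeSemigroup
  using () renaming (interchange to +-interchange)
open import Algebra.Properties.CommutativeSemigroup ℕₚ.*-commutativeSemigroup
  using () renaming (interchange to *-interchange)
open import Algebra.Properties.CommutativeSemigroup ℤₚ.+-commutativeSemigroup
  using () renaming (interchange to ℤ-+-interchange)

true≢false : true ≢ false
true≢false ()

∧-true⁻ : ∀ {x y} → x ∧ y ≡ true → x ≡ true × y ≡ true
∧-true⁻ {true} {true} _ = refl , refl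

∧-true⁺ : ∀ {x y} → x ≡ true → y ≡ true → x ∧ y ≡ true
∧-true⁺ refl refl = refl

∨-true⁺ˡ : ∀ {x} y → x ≡ true → x ∨ y ≡ true
∨-true⁺ˡ y refl = refl

∨-true⁺ʳ : ∀ x {y} → y ≡ true → x ∨ y ≡ true
∨-true⁺ʳ x refl = ∨-zeroʳ x

∨-true⁻ : ∀ {x y} → x ∨ y ≡ true → x ≡ true ⊎ y ≡ true
∨-true⁻ {true}  _ = inj₁ refl
∨-true⁻ {false} e = inj₂ e

-- Finite sums over lists

𝟙 : Bool → ℕ
𝟙 true  = 1
𝟙 false = 0

𝟙-∧ : ∀ x y → 𝟙 (x ∧ y) ≡ 𝟙 x * 𝟙 y
𝟙-∧ true  y = sym (ℕₚ.+-identityʳ (𝟙 y))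
𝟙-∧ false y = refl

∑ : {T : Set} → List T → (T → ℕ) → ℕ
∑ []       f = 0
∑ (t ∷ ts) f = f t + ∑ ts f

syntax ∑ L (λ t → e) = ∑[ t ∈ L ] e


module _ {T : Set} where

  ∑-cong-on : ∀ {D : T → Set} {f g : T → ℕ} (L : List T) → All D L →
              (∀ t → D t → f t ≡ g t) → ∑ L f ≡ ∑ L g
  ∑-cong-on []      []       h = refl
  ∑-cong-on (t ∷ L) (d ∷ ds) h = cong₂ _+_ (h t d) (∑-cong-on L ds h)

  ∑-cong : ∀ {f g : T → ℕ} (L : List T) → (∀ t → f t ≡ g t) → ∑ L f ≡ ∑ L g
  ∑-cong []      h = refl
  ∑-cong (t ∷ L) h = cong₂ _+_ (h t) (∑-cong L h)

  ∑-zero-on : ∀ {D : T → Set} {f : T → ℕ} (L : List T) → All D L →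
              (∀ t → D t → f t ≡ 0) → ∑ L f ≡ 0
  ∑-zero-on []      []       h = refl
  ∑-zero-on (t ∷ L) (d ∷ ds) h = cong₂ _+_ (h t d) (∑-zero-on L ds h)

  ∑-zero : ∀ (L : List T) → ∑[ t ∈ L ] 0 ≡ 0
  ∑-zero []      = refl
  ∑-zero (t ∷ L) = ∑-zero L

  ∑-one : ∀ (L : List T) → ∑[ t ∈ L ] 1 ≡ length L
  ∑-one []      = refl
  ∑-one (t ∷ L) = cong suc (∑-one L)

  ∑-+ : ∀ (L : List T) (f g : T → ℕ) → ∑[ t ∈ L ] (f t + g t) ≡ ∑ L f + ∑ L g
  ∑-+ []      f g = refl
  ∑-+ (t ∷ L) f g = trans (cong (f t + g t +_) (∑-+ L f g)) (+-interchange (f t) (g t) _ _)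

  ∑-*ˡ : ∀ (L : List T) (c : ℕ) (f : T → ℕ) → ∑[ t ∈ L ] (c * f t) ≡ c * ∑ L f
  ∑-*ˡ []      c f = sym (ℕₚ.*-zeroʳ c)
  ∑-*ˡ (t ∷ L) c f = trans (cong (c * f t +_) (∑-*ˡ L c f)) (sym (ℕₚ.*-distribˡ-+ c (f t) _))

  ∑-*ʳ : ∀ (L : List T) (c : ℕ) (f : T → ℕ) → ∑[ t ∈ L ] (f t * c) ≡ ∑ L f * c
  ∑-*ʳ L c f = trans (∑-cong L (λ t → ℕₚ.*-comm (f t) c)) (trans (∑-*ˡ L c f) (ℕₚ.*-comm c _))

  ∑-++ : ∀ (L M : List T) (f : T → ℕ) → ∑ (L ++ M) f ≡ ∑ L f + ∑ M f
  ∑-++ []      M f = refl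
  ∑-++ (t ∷ L) M f = trans (cong (f t +_) (∑-++ L M f)) (sym (ℕₚ.+-assoc (f t) _ _))

module _ {T U : Set} where

  ∑-map : ∀ (g : T → U) (L : List T) (f : U → ℕ) → ∑ (map g L) f ≡ ∑[ t ∈ L ] f (g t)
  ∑-map g []      f = refl
  ∑-map g (t ∷ L) f = cong (f (g t) +_) (∑-map g L f)

  ∑-comm : ∀ (L : List T) (M : List U) (f : T → U → ℕ) →
           ∑[ x ∈ L ] ∑[ y ∈ M ] f x y ≡ ∑[ y ∈ M ] ∑[ x ∈ L ] f x y
  ∑-comm []      M f = sym (∑-zero M)
  ∑-comm (x ∷ L) M f = trans (cong (∑ M (f x) +_) (∑-comm L M f)) (sym (∑-+ M (f x) _))

∑-*-∑ : ∀ {T U : Set} (L : List T) (M : List U) (f : T → ℕ) (g : U → ℕ) →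
        ∑ L f * ∑ M g ≡ ∑[ x ∈ L ] ∑[ y ∈ M ] (f x * g y)
∑-*-∑ L M f g = trans (sym (∑-*ʳ L (∑ M g) f)) (∑-cong L (λ x → sym (∑-*ˡ M (f x) g)))

∑-tabulate : ∀ {T : Set} n (g : Fin n → T) (f : T → ℕ) → ∑ (tabulate g) f ≡ ∑[ i ∈ allFin n ] f (g i)
∑-tabulate zero    g f = refl
∑-tabulate (suc n) g f =
  cong (f (g zero) +_) (trans (∑-tabulate n (g ∘ suc) f) (sym (∑-tabulate n suc (f ∘ g))))

∑-cartesianProductWith : ∀ {T U V : Set} (g : T → U → V) (L : List T) (M : List U) (f : V → ℕ) →
  ∑ (cartesianProductWith g L M) f ≡ ∑[ x ∈ L ] ∑[ y ∈ M ] f (g x y)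
∑-cartesianProductWith g []      M f = refl
∑-cartesianProductWith g (x ∷ L) M f =
  trans (∑-++ (map (g x) M) _ f) (cong₂ _+_ (∑-map (g x) M f) (∑-cartesianProductWith g L M f))

All-cartesianProductWith : ∀ {T U V : Set} {D : T → Set} {E : U → Set} {F : V → Set}
  (g : T → U → V) → (∀ {x y} → D x → E y → F (g x y)) →
  ∀ {L M} → All D L → All E M → All F (cartesianProductWith g L M)
All-cartesianProductWith g pres []       eM = []
All-cartesianProductWith g pres (d ∷ dL) eM =
  Allₚ.++⁺ (Allₚ.map⁺ (All.map (pres d) eM)) (All-cartesianProductWith g pres dL eM)

-- Enumerations and double counting

count-unique : ∀ {T : Set} {H : T → Set} (H? : ∀ t → Dec (H t)) {R : T → T → Set} →
  (∀ {u v} → H u → H v → ¬ R u v) → ∀ L → AllPairs R L → Any H L →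
  ∑[ t ∈ L ] 𝟙 (does (H? t)) ≡ 1
count-unique H? excl (t ∷ L) (rs ∷ _) (here h) =
  cong₂ _+_ (cong 𝟙 (dec-true (H? t) h))
            (∑-zero-on L rs (λ u r → cong 𝟙 (dec-false (H? u) (λ h′ → excl h h′ r))))
count-unique H? excl (t ∷ L) (rs ∷ rss) (there a) =
  cong₂ _+_ (cong 𝟙 (dec-false (H? t) (λ h → All.lookupWith (λ r h′ → excl h h′ r) rs a)))
            (count-unique H? excl L rss a)

record Enumeration {T : Set} (_≟_ : DecidableEquality T) (D : T → Set) : Set where
  field
    elems     : List T
    elems-in  : All D elems
    each-once : ∀ t → D t → ∑[ u ∈ elems ] 𝟙 (does (u ≟ t)) ≡ 1

allFin-enumeration : ∀ n → Enumeration (Fin._≟_ {n}) (λ _ → Fin n)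
allFin-enumeration n = record
  { elems = allFin n ; elems-in = Allₚ.tabulate⁺ id ; each-once = λ j _ → once n j }
  where
  once : ∀ n (j : Fin n) → ∑[ i ∈ allFin n ] 𝟙 (does (i Fin.≟ j)) ≡ 1
  once (suc n) zero    = cong suc (trans (∑-tabulate n suc _) (∑-zero (allFin n)))
  once (suc n) (suc j) = trans (∑-tabulate n suc _)
    (trans (∑-cong (allFin n) (λ i → cong 𝟙 (does-⇔ (mk⇔ Finₚ.suc-injective (cong suc))
                                                     (suc i Fin.≟ suc j) (i Fin.≟ j))))
           (once n j))

module _ {T U V : Set} {_≟T_ : DecidableEquality T} {_≟U_ : DecidableEquality U}
         {D : T → Set} {E : U → Set} (_≟V_ : DecidableEquality V) (g : T → U → V)
         (g-injective : ∀ {x x′ y y′} → g x y ≡ g x′ y′ → x ≡ x′ × y ≡ y′)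
         (EL : Enumeration _≟T_ D) (EM : Enumeration _≟U_ E) where
  open Enumeration

  cartesianProductWith-once : ∀ {x y} → D x → E y →
    ∑[ v ∈ cartesianProductWith g (elems EL) (elems EM) ] 𝟙 (does (v ≟V g x y)) ≡ 1
  cartesianProductWith-once {x} {y} dx ey = begin
      ∑[ v ∈ cartesianProductWith g (elems EL) (elems EM) ] 𝟙 (does (v ≟V g x y))
    ≡⟨ ∑-cartesianProductWith g (elems EL) (elems EM) _ ⟩
      ∑[ x′ ∈ elems EL ] ∑[ y′ ∈ elems EM ] 𝟙 (does (g x′ y′ ≟V g x y))
    ≡⟨ ∑-cong (elems EL) (λ x′ → ∑-cong (elems EM) (λ y′ → split x′ y′)) ⟩
      ∑[ x′ ∈ elems EL ] ∑[ y′ ∈ elems EM ] (𝟙 (does (x′ ≟T x)) * 𝟙 (does (y′ ≟U y)))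
    ≡⟨ ∑-cong (elems EL) (λ x′ → ∑-*ˡ (elems EM) (𝟙 (does (x′ ≟T x))) _) ⟩
      ∑[ x′ ∈ elems EL ] (𝟙 (does (x′ ≟T x)) * ∑[ y′ ∈ elems EM ] 𝟙 (does (y′ ≟U y)))
    ≡⟨ ∑-cong (elems EL) (λ x′ → trans (cong (𝟙 (does (x′ ≟T x)) *_) (each-once EM y ey))
                                       (ℕₚ.*-identityʳ _)) ⟩
      ∑[ x′ ∈ elems EL ] 𝟙 (does (x′ ≟T x))
    ≡⟨ each-once EL x dx ⟩
      1 ∎
    where
    open ≡-Reasoning
    split : ∀ x′ y′ → 𝟙 (does (g x′ y′ ≟V g x y)) ≡ 𝟙 (does (x′ ≟T x)) * 𝟙 (does (y′ ≟U y))
    split x′ y′ = trans (cong 𝟙 (does-⇔ (mk⇔ g-injective (λ (p , q) → cong₂ g p q))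
                                         (g x′ y′ ≟V g x y) ((x′ ≟T x) ×-dec (y′ ≟U y))))
                        (𝟙-∧ (does (x′ ≟T x)) (does (y′ ≟U y)))

_×-enumeration_ : ∀ {T U : Set} {_≟T_ : DecidableEquality T} {_≟U_ : DecidableEquality U}
  {D : T → Set} {E : U → Set} → Enumeration _≟T_ D → Enumeration _≟U_ E →
  Enumeration (Productₚ.≡-dec _≟T_ _≟U_) (λ p → D (proj₁ p) × E (proj₂ p))
_×-enumeration_ {_≟T_ = _≟T_} {_≟U_} EL EM = record
  { elems     = cartesianProduct (elems EL) (elems EM)
  ; elems-in  = All-cartesianProductWith _,_ _,_ (elems-in EL) (elems-in EM)
  ; each-once = λ (x , y) (d , e) →
      cartesianProductWith-once (Productₚ.≡-dec _≟T_ _≟U_) _,_ Productₚ.,-injective EL EM d e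
  }
  where open Enumeration

words-enumeration : ∀ s n → Enumeration (Listₚ.≡-dec (Fin._≟_ {s})) (λ w → length w ≡ n)
words-enumeration s zero    = record
  { elems = [] ∷ [] ; elems-in = refl ∷ [] ; each-once = λ { [] refl → refl } }
words-enumeration s (suc n) = record
  { elems     = cartesianProductWith _∷_ (allFin s) (elems (words-enumeration s n))
  ; elems-in  = All-cartesianProductWith _∷_ (λ _ e → cong suc e)
                  (elems-in (allFin-enumeration s)) (elems-in (words-enumeration s n))
  ; each-once = λ { (b ∷ w) e → cartesianProductWith-once (Listₚ.≡-dec Fin._≟_) _∷_ Listₚ.∷-injective
                                  (allFin-enumeration s) (words-enumeration s n) b (ℕₚ.suc-injective e) }
  }
  where open Enumeration

record _⇿_ {T U : Set} (S : T → Set) (S′ : U → Set) : Set where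
  field
    to       : T → U
    from     : U → T
    to-in    : ∀ {t} → S t → S′ (to t)
    from-in  : ∀ {u} → S′ u → S (from u)
    from∘to  : ∀ {t} → S t → from (to t) ≡ t
    to∘from  : ∀ {u} → S′ u → to (from u) ≡ u

-- Double counting the pairs (t , u) with u ≡ to t.
count-bijection : ∀ {T U : Set} {_≟T_ : DecidableEquality T} {_≟U_ : DecidableEquality U}
  {D : T → Set} {D′ : U → Set} (E : Enumeration _≟T_ D) (E′ : Enumeration _≟U_ D′)
  (P : T → Bool) (P′ : U → Bool) →
  (λ t → D t × P t ≡ true) ⇿ (λ u → D′ u × P′ u ≡ true) →
  ∑[ t ∈ Enumeration.elems E ] 𝟙 (P t) ≡ ∑[ u ∈ Enumeration.elems E′ ] 𝟙 (P′ u)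
count-bijection {_≟T_ = _≟T_} {_≟U_} {D} {D′} E E′ P P′ bij = begin
    ∑[ t ∈ elems E ] 𝟙 (P t)
  ≡⟨ ∑-cong-on (elems E) (elems-in E) fiber-of-to ⟩
    ∑[ t ∈ elems E ] ∑[ u ∈ elems E′ ] (𝟙 (P t) * 𝟙 (does (u ≟U to t)))
  ≡⟨ ∑-comm (elems E) (elems E′) _ ⟩
    ∑[ u ∈ elems E′ ] ∑[ t ∈ elems E ] (𝟙 (P t) * 𝟙 (does (u ≟U to t)))
  ≡⟨ ∑-cong-on (elems E′) (elems-in E′) preimage-count ⟩
    ∑[ u ∈ elems E′ ] 𝟙 (P′ u) ∎
  where
  open ≡-Reasoning
  open Enumeration
  open _⇿_ bij

  fiber-of-to : ∀ t → D t → 𝟙 (P t) ≡ ∑[ u ∈ elems E′ ] (𝟙 (P t) * 𝟙 (does (u ≟U to t)))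
  fiber-of-to t d with P t in pt
  ... | true  = sym (trans (∑-*ˡ (elems E′) 1 _) (trans (ℕₚ.+-identityʳ _)
                  (each-once E′ (to t) (proj₁ (to-in (d , pt))))))
  ... | false = sym (∑-zero (elems E′))

  preimage-count : ∀ u → D′ u → ∑[ t ∈ elems E ] (𝟙 (P t) * 𝟙 (does (u ≟U to t))) ≡ 𝟙 (P′ u)
  preimage-count u d′ with P′ u in p′u
  ... | true  = trans (∑-cong-on (elems E) (elems-in E) term) (each-once E (from u) (proj₁ (from-in (d′ , p′u))))
    where
    term : ∀ t → D t → 𝟙 (P t) * 𝟙 (does (u ≟U to t)) ≡ 𝟙 (does (t ≟T from u))
    term t d with P t in pt
    ... | true  = trans (ℕₚ.+-identityʳ _) (cong 𝟙 (does-⇔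
                    (mk⇔ (λ u≡ → trans (sym (from∘to (d , pt))) (cong from (sym u≡)))
                         (λ t≡ → trans (sym (to∘from (d′ , p′u))) (cong to (sym t≡))))
                    (u ≟U to t) (t ≟T from u)))
    ... | false = sym (cong 𝟙 (dec-false (t ≟T from u)
                    (λ { refl → true≢false (trans (sym (proj₂ (from-in (d′ , p′u)))) pt) })))
  ... | false = ∑-zero-on (elems E) (elems-in E) term
    where
    term : ∀ t → D t → 𝟙 (P t) * 𝟙 (does (u ≟U to t)) ≡ 0
    term t d with P t in pt
    ... | true  = trans (ℕₚ.+-identityʳ _) (cong 𝟙 (dec-false (u ≟U to t)
                    (λ { refl → true≢false (trans (sym (proj₂ (to-in (d , pt)))) p′u) })))
    ... | false = refl

-- Sums of integer sequences

sumUpTo-cong : ∀ n {f g : ℕ → ℤ} → (∀ k → k ≤ n → f k ≡ g k) → sumUpTo n f ≡ sumUpTo n g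
sumUpTo-cong zero    h = h 0 z≤n
sumUpTo-cong (suc n) h =
  cong₂ ℤ._+_ (sumUpTo-cong n (λ k k≤n → h k (ℕₚ.m≤n⇒m≤1+n k≤n))) (h (suc n) ℕₚ.≤-refl)

sumUpTo-unfoldˡ : ∀ n (f : ℕ → ℤ) → sumUpTo (suc n) f ≡ f 0 ℤ.+ sumUpTo n (f ∘ suc)
sumUpTo-unfoldˡ zero    f = refl
sumUpTo-unfoldˡ (suc n) f = trans (cong (ℤ._+ f (2 + n)) (sumUpTo-unfoldˡ n f)) (ℤₚ.+-assoc (f 0) _ _)

sumUpTo-reflect : ∀ n (f : ℕ → ℤ) → sumUpTo n (λ k → f (n ∸ k)) ≡ sumUpTo n f
sumUpTo-reflect zero    f = refl
sumUpTo-reflect (suc n) f = begin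
    sumUpTo n (λ k → f (suc n ∸ k)) ℤ.+ f (n ∸ n)
  ≡⟨ cong₂ ℤ._+_ (sumUpTo-cong n (λ k k≤n → cong f (ℕₚ.+-∸-assoc 1 k≤n))) (cong f (ℕₚ.n∸n≡0 n)) ⟩
    sumUpTo n (λ k → f (suc (n ∸ k))) ℤ.+ f 0
  ≡⟨ cong (ℤ._+ f 0) (sumUpTo-reflect n (f ∘ suc)) ⟩
    sumUpTo n (f ∘ suc) ℤ.+ f 0
  ≡⟨ trans (ℤₚ.+-comm _ (f 0)) (sym (sumUpTo-unfoldˡ n f)) ⟩
    sumUpTo (suc n) f ∎
  where open ≡-Reasoning

sumUpTo-alternating-telescope : ∀ n (B C : ℕ → ℕ) → B 0 ≡ 0 → (∀ k → k < n → B (suc k) ≡ C k) →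
  sumUpTo n (λ k → sign k ℤ.* ℤ.+ (B k + C k)) ≡ sign n ℤ.* ℤ.+ C n
sumUpTo-alternating-telescope zero    B C B0 BC rewrite B0 = refl
sumUpTo-alternating-telescope (suc n) B C B0 BC
  rewrite sumUpTo-alternating-telescope n B C B0 (λ k k<n → BC k (ℕₚ.m≤n⇒m≤1+n k<n))
        | BC n ℕₚ.≤-refl | ℤₚ.pos-+ (C n) (C (suc n)) = cancel (sign n) (ℤ.+ C n) (ℤ.+ C (suc n))
  where
  cancel : ∀ s c d → s ℤ.* c ℤ.+ (ℤ.- s) ℤ.* (c ℤ.+ d) ≡ (ℤ.- s) ℤ.* d
  cancel = solve-∀

sumFin-cong : ∀ m {f g : Fin m → ℤ} → (∀ i → f i ≡ g i) → sumFin m f ≡ sumFin m g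
sumFin-cong zero    h = refl
sumFin-cong (suc m) h = cong₂ ℤ._+_ (h zero) (sumFin-cong m (h ∘ suc))

sumFin-+ : ∀ m (f g : Fin m → ℤ) → sumFin m (λ i → f i ℤ.+ g i) ≡ sumFin m f ℤ.+ sumFin m g
sumFin-+ zero    f g = refl
sumFin-+ (suc m) f g = trans (cong (λ r → f zero ℤ.+ g zero ℤ.+ r) (sumFin-+ m (f ∘ suc) (g ∘ suc)))
                             (ℤ-+-interchange (f zero) (g zero) _ _)

sumFin-sumUpTo-comm : ∀ m n (F : Fin m → ℕ → ℤ) →
  sumFin m (λ i → sumUpTo n (F i)) ≡ sumUpTo n (λ k → sumFin m (λ i → F i k))
sumFin-sumUpTo-comm m zero    F = refl
sumFin-sumUpTo-comm m (suc n) F =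
  trans (sumFin-+ m _ _) (cong (ℤ._+ sumFin m (λ i → F i (suc n))) (sumFin-sumUpTo-comm m n F))

sumFin-*ˡ : ∀ m (c : ℤ) (f : Fin m → ℤ) → sumFin m (λ i → c ℤ.* f i) ≡ c ℤ.* sumFin m f
sumFin-*ˡ zero    c f = sym (ℤₚ.*-zeroʳ c)
sumFin-*ˡ (suc m) c f =
  trans (cong (λ r → c ℤ.* f zero ℤ.+ r) (sumFin-*ˡ m c (f ∘ suc))) (sym (ℤₚ.*-distribˡ-+ c (f zero) _))

sumFin-+_ : ∀ m (f : Fin m → ℕ) → sumFin m (λ i → ℤ.+ f i) ≡ ℤ.+ ∑[ i ∈ allFin m ] f i
sumFin-+_ zero    f = refl
sumFin-+_ (suc m) f = begin
    ℤ.+ f zero ℤ.+ sumFin m (λ i → ℤ.+ f (suc i))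
  ≡⟨ cong (λ r → ℤ.+ f zero ℤ.+ r) (sumFin-+_ m (f ∘ suc)) ⟩
    ℤ.+ f zero ℤ.+ ℤ.+ ∑[ i ∈ allFin m ] f (suc i)
  ≡⟨ sym (ℤₚ.pos-+ (f zero) _) ⟩
    ℤ.+ (f zero + ∑[ i ∈ allFin m ] f (suc i))
  ≡⟨ cong (λ r → ℤ.+ (f zero + r)) (sym (∑-tabulate m suc f)) ⟩
    ℤ.+ ∑[ i ∈ allFin (suc m) ] f i ∎
  where open ≡-Reasoning

sumFin-sumUpTo-signed : ∀ m n (σ : ℕ → ℤ) (f : Fin m → ℕ → ℕ) →
  sumFin m (λ i → sumUpTo n (λ k → σ k ℤ.* ℤ.+ f i k))
  ≡ sumUpTo n (λ k → σ k ℤ.* ℤ.+ ∑[ i ∈ allFin m ] f i k)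
sumFin-sumUpTo-signed m n σ f = trans (sumFin-sumUpTo-comm m n _)
  (sumUpTo-cong n (λ k _ → trans (sumFin-*ˡ m (σ k) _) (cong (σ k ℤ.*_) (sumFin-+_ m (λ i → f i k)))))

*-signedˡ : ∀ σ a b → (σ ℤ.* ℤ.+ a) ℤ.* ℤ.+ b ≡ σ ℤ.* ℤ.+ (a * b)
*-signedˡ σ a b = trans (ℤₚ.*-assoc σ (ℤ.+ a) (ℤ.+ b)) (cong (σ ℤ.*_) (sym (ℤₚ.pos-* a b)))

*-signedʳ : ∀ σ a b → ℤ.+ a ℤ.* (σ ℤ.* ℤ.+ b) ≡ σ ℤ.* ℤ.+ (a * b)
*-signedʳ σ a b = trans (sym (ℤₚ.*-assoc (ℤ.+ a) σ (ℤ.+ b)))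
                        (trans (cong (ℤ._* ℤ.+ b) (ℤₚ.*-comm (ℤ.+ a) σ)) (*-signedˡ σ a b))

-- Least search in Fin n

least : ∀ {n} → (Fin n → Bool) → Maybe (Fin n)
least {zero}  P = nothing
least {suc n} P = if P zero then just zero else Maybe.map suc (least (P ∘ suc))

least-cong : ∀ {n} {P Q : Fin n → Bool} → (∀ i → P i ≡ Q i) → least P ≡ least Q
least-cong {zero}          h = refl
least-cong {suc n} {P} {Q} h rewrite h zero =
  cong (λ r → if Q zero then just zero else Maybe.map suc r) (least-cong (h ∘ suc))

least-satisfies : ∀ {n} (P : Fin n → Bool) {a} → least P ≡ just a → P a ≡ true
least-satisfies {suc n} P {a} e with P zero in p0
least-satisfies {suc n} P {zero} refl | true = p0
... | false with least (P ∘ suc) in e′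
least-satisfies {suc n} P {suc a} refl | false | just a = least-satisfies (P ∘ suc) e′

least-minimal : ∀ {n} (P : Fin n → Bool) {a} → least P ≡ just a → ∀ b → b Fin.< a → P b ≡ false
least-minimal {suc n} P {a} e b b<a with P zero in p0
least-minimal {suc n} P {zero} refl b () | true
... | false with least (P ∘ suc) in e′
least-minimal {suc n} P {suc a} refl zero    b<a       | false | just a = p0
least-minimal {suc n} P {suc a} refl (suc b) (s≤s b<a) | false | just a = least-minimal (P ∘ suc) e′ b b<a

least-nothing : ∀ {n} (P : Fin n → Bool) → least P ≡ nothing → ∀ a → P a ≡ false
least-nothing {suc n} P e a with P zero in p0
least-nothing {suc n} P () a | true
... | false with least (P ∘ suc) in e′
least-nothing {suc n} P e zero    | false | nothing = p0
least-nothing {suc n} P e (suc a) | false | nothing = least-nothing (P ∘ suc) e′ a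

least≡just : ∀ {n} (P : Fin n → Bool) {a} → P a ≡ true → (∀ b → b Fin.< a → P b ≡ false) →
               least P ≡ just a
least≡just {suc n} P {zero}  pa below rewrite pa = refl
least≡just {suc n} P {suc a} pa below rewrite below zero (s≤s z≤n) =
  cong (Maybe.map suc) (least≡just (P ∘ suc) pa (λ b b<a → below (suc b) (s≤s b<a)))

module Traces (A : IndepAlphabet) where
  open IndepAlphabet A

  infix 4 _≈_
  _≈_ : Word A → Word A → Set
  _≈_ = _~_ A

  ≈-swap : ∀ {a b} v → Ind a b → a ∷ b ∷ v ≈ b ∷ a ∷ v
  ≈-swap v i = ~-swap [] v i

  ≈-++ˡ : ∀ w {u v} → u ≈ v → w ++ u ≈ w ++ v
  ≈-++ˡ w ~-refl        = ~-refl
  ≈-++ˡ w (~-sym p)     = ~-sym (≈-++ˡ w p)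
  ≈-++ˡ w (~-trans p q) = ~-trans (≈-++ˡ w p) (≈-++ˡ w q)
  ≈-++ˡ w (~-swap u v {a} {b} i) =
    subst₂ _≈_ (Listₚ.++-assoc w u (a ∷ b ∷ v)) (Listₚ.++-assoc w u (b ∷ a ∷ v)) (~-swap (w ++ u) v i)

  ≈-++ʳ : ∀ w {u v} → u ≈ v → u ++ w ≈ v ++ w
  ≈-++ʳ w ~-refl        = ~-refl
  ≈-++ʳ w (~-sym p)     = ~-sym (≈-++ʳ w p)
  ≈-++ʳ w (~-trans p q) = ~-trans (≈-++ʳ w p) (≈-++ʳ w q)
  ≈-++ʳ w (~-swap u v {a} {b} i) =
    subst₂ _≈_ (sym (Listₚ.++-assoc u (a ∷ b ∷ v) w)) (sym (Listₚ.++-assoc u (b ∷ a ∷ v) w)) (~-swap u (v ++ w) i)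

  ≈-∷ : ∀ a {u v} → u ≈ v → a ∷ u ≈ a ∷ v
  ≈-∷ a = ≈-++ˡ [ a ]

  ≈-++ : ∀ {u u′ v v′} → u ≈ u′ → v ≈ v′ → u ++ v ≈ u′ ++ v′
  ≈-++ {u′ = u′} {v} p q = ~-trans (≈-++ʳ v p) (≈-++ˡ u′ q)

  ≈-invariant : ∀ {X : Set} (F : Word A → X) →
    (∀ u v {a b} → Ind a b → F (u ++ a ∷ b ∷ v) ≡ F (u ++ b ∷ a ∷ v)) →
    ∀ {u v} → u ≈ v → F u ≡ F v
  ≈-invariant F swap ~-refl         = refl
  ≈-invariant F swap (~-sym p)      = sym (≈-invariant F swap p)
  ≈-invariant F swap (~-trans p q)  = trans (≈-invariant F swap p) (≈-invariant F swap q)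
  ≈-invariant F swap (~-swap u v i) = swap u v i

  ≈-invariant-cons : ∀ {X : Set} (F : Word A → X) (g : Letter A → X → X) →
    (∀ x w → F (x ∷ w) ≡ g x (F w)) →
    (∀ {a b} r → Ind a b → g a (g b r) ≡ g b (g a r)) →
    ∀ {u v} → u ≈ v → F u ≡ F v
  ≈-invariant-cons F g F-cons g-swap = ≈-invariant F go
    where
    go : ∀ u v {a b} → Ind a b → F (u ++ a ∷ b ∷ v) ≡ F (u ++ b ∷ a ∷ v)
    go []      v {a} {b} i = begin
      F (a ∷ b ∷ v)     ≡⟨ trans (F-cons a _) (cong (g a) (F-cons b v)) ⟩
      g a (g b (F v))   ≡⟨ g-swap (F v) i ⟩
      g b (g a (F v))   ≡⟨ sym (trans (F-cons b _) (cong (g b) (F-cons a v))) ⟩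
      F (b ∷ a ∷ v)     ∎
      where open ≡-Reasoning
    go (x ∷ u) v i = trans (F-cons x _) (trans (cong (g x) (go u v i)) (sym (F-cons x _)))

  ≈-length : ∀ {u v} → u ≈ v → length u ≡ length v
  ≈-length = ≈-invariant-cons length (λ _ → suc) (λ _ _ → refl) (λ _ _ → refl)

  ≈-reverse : ∀ {u v} → u ≈ v → reverse u ≈ reverse v
  ≈-reverse ~-refl        = ~-refl
  ≈-reverse (~-sym p)     = ~-sym (≈-reverse p)
  ≈-reverse (~-trans p q) = ~-trans (≈-reverse p) (≈-reverse q)
  ≈-reverse (~-swap u v {a} {b} i) =
    subst₂ _≈_ (sym (reverse-swap a b)) (sym (reverse-swap b a)) (~-swap (reverse v) (reverse u) (Ind-sym a b i))
    where
    reverse-swap : ∀ a b → reverse (u ++ a ∷ b ∷ v) ≡ reverse v ++ b ∷ a ∷ reverse u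
    reverse-swap a b = begin
        reverse (u ++ a ∷ b ∷ v)
      ≡⟨ Listₚ.reverse-++ u (a ∷ b ∷ v) ⟩
        reverse (a ∷ b ∷ v) ++ reverse u
      ≡⟨ cong (_++ reverse u) (Listₚ.reverse-++ (a ∷ b ∷ []) v) ⟩
        (reverse v ++ b ∷ a ∷ []) ++ reverse u
      ≡⟨ Listₚ.++-assoc (reverse v) (b ∷ a ∷ []) (reverse u) ⟩
        reverse v ++ b ∷ a ∷ reverse u ∎
      where open ≡-Reasoning

  Ind⇒≢ : ∀ {a b} → Ind a b → a ≢ b
  Ind⇒≢ {a} i refl = Ind-irr a i

  Indᵇ : Letter A → Letter A → Bool
  Indᵇ a b = does (Ind-dec a b)

  Indᵇ-sound : ∀ {a b} → Indᵇ a b ≡ true → Ind a b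
  Indᵇ-sound {a} {b} e with Ind-dec a b
  ... | yes i = i
  Indᵇ-sound () | no _

  Indᵇ-complete : ∀ {a b} → Ind a b → Indᵇ a b ≡ true
  Indᵇ-complete {a} {b} = dec-true (Ind-dec a b)

  Indᵇ-sym : ∀ a b → Indᵇ a b ≡ Indᵇ b a
  Indᵇ-sym a b = does-⇔ (mk⇔ (Ind-sym a b) (Ind-sym b a)) (Ind-dec a b) (Ind-dec b a)

  Indᵇ-irr : ∀ a → Indᵇ a a ≡ false
  Indᵇ-irr a = dec-false (Ind-dec a a) (Ind-irr a)

  _∈ᵇ_ : Letter A → Word A → Bool
  a ∈ᵇ []      = false
  a ∈ᵇ (b ∷ w) = does (a Fin.≟ b) ∨ a ∈ᵇ w

  IndAllᵇ : Letter A → Word A → Bool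
  IndAllᵇ a []      = true
  IndAllᵇ a (b ∷ w) = Indᵇ a b ∧ IndAllᵇ a w

  -- a occurs in w and commutes with everything before its first occurrence,
  -- i.e. the trace of w begins with a.
  Minimalᵇ : Letter A → Word A → Bool
  Minimalᵇ a []      = false
  Minimalᵇ a (b ∷ w) = does (a Fin.≟ b) ∨ (Indᵇ a b ∧ Minimalᵇ a w)

  delete : Letter A → Word A → Word A
  delete a []      = []
  delete a (b ∷ w) = if does (a Fin.≟ b) then w else b ∷ delete a w

  Cliqueᵇ : Word A → Bool
  Cliqueᵇ []      = true
  Cliqueᵇ (b ∷ w) = IndAllᵇ b w ∧ Cliqueᵇ w

  ∈ᵇ-≈ : ∀ a {u v} → u ≈ v → a ∈ᵇ u ≡ a ∈ᵇ v
  ∈ᵇ-≈ a = ≈-invariant-cons (a ∈ᵇ_) (λ b r → does (a Fin.≟ b) ∨ r) (λ _ _ → refl)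
             (λ {x} {y} r _ → ∨-swapˡ (does (a Fin.≟ x)) (does (a Fin.≟ y)) r)

  IndAllᵇ-≈ : ∀ a {u v} → u ≈ v → IndAllᵇ a u ≡ IndAllᵇ a v
  IndAllᵇ-≈ a = ≈-invariant-cons (IndAllᵇ a) (λ b r → Indᵇ a b ∧ r) (λ _ _ → refl)
                  (λ {x} {y} r _ → ∧-swapˡ (Indᵇ a x) (Indᵇ a y) r)

  Minimalᵇ-≈ : ∀ a {u v} → u ≈ v → Minimalᵇ a u ≡ Minimalᵇ a v
  Minimalᵇ-≈ a = ≈-invariant-cons (Minimalᵇ a) (λ b r → does (a Fin.≟ b) ∨ (Indᵇ a b ∧ r)) (λ _ _ → refl) swap
    where
    swap : ∀ {x y} r → Ind x y → does (a Fin.≟ x) ∨ (Indᵇ a x ∧ (does (a Fin.≟ y) ∨ (Indᵇ a y ∧ r)))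
                               ≡ does (a Fin.≟ y) ∨ (Indᵇ a y ∧ (does (a Fin.≟ x) ∨ (Indᵇ a x ∧ r)))
    swap {x} {y} r i with a Fin.≟ x | a Fin.≟ y
    ... | yes refl | yes refl = ⊥-elim (Ind-irr a i)
    ... | yes refl | no _     = sym (cong (_∧ true) (Indᵇ-complete i))
    ... | no _     | yes refl = cong (_∧ true) (Indᵇ-complete (Ind-sym x a i))
    ... | no _     | no _     = ∧-swapˡ (Indᵇ a x) (Indᵇ a y) r

  Cliqueᵇ-≈ : ∀ {u v} → u ≈ v → Cliqueᵇ u ≡ Cliqueᵇ v
  Cliqueᵇ-≈ = ≈-invariant Cliqueᵇ go
    where
    go : ∀ u v {x y} → Ind x y → Cliqueᵇ (u ++ x ∷ y ∷ v) ≡ Cliqueᵇ (u ++ y ∷ x ∷ v)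
    go (z ∷ u) v i = cong₂ _∧_ (IndAllᵇ-≈ z (~-swap u v i)) (go u v i)
    go []      v {x} {y} i rewrite Indᵇ-complete i | Indᵇ-complete (Ind-sym x y i) =
      ∧-swapˡ (IndAllᵇ x v) (IndAllᵇ y v) (Cliqueᵇ v)

  delete-≈ : ∀ a {u v} → u ≈ v → delete a u ≈ delete a v
  delete-≈ a ~-refl         = ~-refl
  delete-≈ a (~-sym p)      = ~-sym (delete-≈ a p)
  delete-≈ a (~-trans p q)  = ~-trans (delete-≈ a p) (delete-≈ a q)
  delete-≈ a (~-swap u v i) = go u v i
    where
    go : ∀ u v {x y} → Ind x y → delete a (u ++ x ∷ y ∷ v) ≈ delete a (u ++ y ∷ x ∷ v)
    go (z ∷ u) v i with a Fin.≟ z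
    ... | yes _ = ~-swap u v i
    ... | no _  = ≈-∷ z (go u v i)
    go []      v {x} {y} i with a Fin.≟ x | a Fin.≟ y
    ... | yes refl | yes refl = ⊥-elim (Ind-irr a i)
    ... | yes refl | no _     = ~-refl
    ... | no _     | yes refl = ~-refl
    ... | no _     | no _     = ≈-swap (delete a v) i

  ∈ᵇ-head : ∀ a w → a ∈ᵇ (a ∷ w) ≡ true
  ∈ᵇ-head a w = cong (_∨ a ∈ᵇ w) (dec-true (a Fin.≟ a) refl)

  Minimalᵇ-head : ∀ a w → Minimalᵇ a (a ∷ w) ≡ true
  Minimalᵇ-head a w = cong (_∨ (Indᵇ a a ∧ Minimalᵇ a w)) (dec-true (a Fin.≟ a) refl)

  delete-head : ∀ a w → delete a (a ∷ w) ≡ w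
  delete-head a w = cong (if_then w else (a ∷ delete a w)) (dec-true (a Fin.≟ a) refl)

  ∈ᵇ-≢ : ∀ {a b} w → a ≢ b → a ∈ᵇ (b ∷ w) ≡ a ∈ᵇ w
  ∈ᵇ-≢ {a} {b} w a≢b = cong (_∨ a ∈ᵇ w) (dec-false (a Fin.≟ b) a≢b)

  Minimalᵇ-≢ : ∀ {a b} w → a ≢ b → Minimalᵇ a (b ∷ w) ≡ Indᵇ a b ∧ Minimalᵇ a w
  Minimalᵇ-≢ {a} {b} w a≢b = cong (_∨ (Indᵇ a b ∧ Minimalᵇ a w)) (dec-false (a Fin.≟ b) a≢b)

  Minimalᵇ⇒∈ᵇ : ∀ a w → Minimalᵇ a w ≡ true → a ∈ᵇ w ≡ true
  Minimalᵇ⇒∈ᵇ a (b ∷ w) e with a Fin.≟ b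
  ... | yes _ = refl
  ... | no _  = Minimalᵇ⇒∈ᵇ a w (proj₂ (∧-true⁻ e))

  Minimalᵇ⇒≈∷delete : ∀ a w → Minimalᵇ a w ≡ true → w ≈ a ∷ delete a w
  Minimalᵇ⇒≈∷delete a (b ∷ w) e with a Fin.≟ b
  ... | yes refl = ~-refl
  ... | no _     = let i , m = ∧-true⁻ e in
    ~-trans (≈-∷ b (Minimalᵇ⇒≈∷delete a w m)) (≈-swap (delete a w) (Ind-sym a b (Indᵇ-sound i)))

  length-delete : ∀ a w → a ∈ᵇ w ≡ true → suc (length (delete a w)) ≡ length w
  length-delete a (b ∷ w) e with a Fin.≟ b
  ... | yes _ = refl
  ... | no _  = cong suc (length-delete a w e)

  ∈ᵇ-delete⁻ : ∀ a b w → b ∈ᵇ delete a w ≡ true → b ∈ᵇ w ≡ true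
  ∈ᵇ-delete⁻ a b (c ∷ w) e with a Fin.≟ c | b Fin.≟ c
  ... | _     | yes _ = refl
  ... | yes _ | no _  = e
  ... | no _  | no b≢c = ∈ᵇ-delete⁻ a b w (trans (sym (∈ᵇ-≢ (delete a w) b≢c)) e)

  IndAllᵇ-∈ᵇ : ∀ b a w → IndAllᵇ b w ≡ true → a ∈ᵇ w ≡ true → Indᵇ b a ≡ true
  IndAllᵇ-∈ᵇ b a (c ∷ w) e m with a Fin.≟ c
  ... | yes refl = proj₁ (∧-true⁻ e)
  ... | no _     = IndAllᵇ-∈ᵇ b a w (proj₂ (∧-true⁻ {Indᵇ b c} e)) m

  IndAllᵇ⇒∷ʳ≈∷ : ∀ a u → IndAllᵇ a u ≡ true → u ++ [ a ] ≈ a ∷ u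
  IndAllᵇ⇒∷ʳ≈∷ a []      e = ~-refl
  IndAllᵇ⇒∷ʳ≈∷ a (b ∷ u) e = let i , e′ = ∧-true⁻ e in
    ~-trans (≈-∷ b (IndAllᵇ⇒∷ʳ≈∷ a u e′)) (≈-swap u (Ind-sym a b (Indᵇ-sound i)))

  Cliqueᵇ-Minimalᵇ : ∀ a c → Cliqueᵇ c ≡ true → a ∈ᵇ c ≡ true → Minimalᵇ a c ≡ true
  Cliqueᵇ-Minimalᵇ a (b ∷ c) e m with a Fin.≟ b
  ... | yes _ = refl
  ... | no _  = let e₁ , e₂ = ∧-true⁻ {IndAllᵇ b c} e in
    ∧-true⁺ (trans (Indᵇ-sym a b) (IndAllᵇ-∈ᵇ b a c e₁ m)) (Cliqueᵇ-Minimalᵇ a c e₂ m)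

  Cliqueᵇ-∉ᵇ-delete : ∀ a c → Cliqueᵇ c ≡ true → a ∈ᵇ delete a c ≡ false
  Cliqueᵇ-∉ᵇ-delete a []      e = refl
  Cliqueᵇ-∉ᵇ-delete a (b ∷ c) e with a Fin.≟ b
  ... | yes refl = ¬-not λ m →
    true≢false (trans (sym (IndAllᵇ-∈ᵇ a a c (proj₁ (∧-true⁻ {IndAllᵇ a c} e)) m)) (Indᵇ-irr a))
  ... | no a≢b   = trans (∈ᵇ-≢ (delete a c) a≢b) (Cliqueᵇ-∉ᵇ-delete a c (proj₂ (∧-true⁻ {IndAllᵇ b c} e)))

  Cliqueᵇ-delete : ∀ a c → Cliqueᵇ c ≡ true → a ∈ᵇ c ≡ true →
                   IndAllᵇ a (delete a c) ≡ true × Cliqueᵇ (delete a c) ≡ true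
  Cliqueᵇ-delete a c e m =
    ∧-true⁻ (trans (sym (Cliqueᵇ-≈ (Minimalᵇ⇒≈∷delete a c (Cliqueᵇ-Minimalᵇ a c e m)))) e)

  Cliqueᵇ⇒≈reverse : ∀ c → Cliqueᵇ c ≡ true → c ≈ reverse c
  Cliqueᵇ⇒≈reverse []      e = ~-refl
  Cliqueᵇ⇒≈reverse (b ∷ c) e =
    subst (b ∷ c ≈_) (sym (Listₚ.unfold-reverse b c))
      (~-sym (~-trans (IndAllᵇ⇒∷ʳ≈∷ b (reverse c) (trans (sym (IndAllᵇ-≈ b c≈rc)) e₁)) (≈-∷ b (~-sym c≈rc))))
    where
    e₁ = proj₁ (∧-true⁻ {IndAllᵇ b c} e)
    c≈rc = Cliqueᵇ⇒≈reverse c (proj₂ (∧-true⁻ {IndAllᵇ b c} e))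

  IndAllᵇ⁺ : ∀ b w → All (_∥_ A b) w → IndAllᵇ b w ≡ true
  IndAllᵇ⁺ b []      []             = refl
  IndAllᵇ⁺ b (c ∷ w) ((_ , i) ∷ bw) = ∧-true⁺ (Indᵇ-complete i) (IndAllᵇ⁺ b w bw)

  IndAllᵇ⁻ : ∀ b w → IndAllᵇ b w ≡ true → All (_∥_ A b) w
  IndAllᵇ⁻ b []      e = []
  IndAllᵇ⁻ b (c ∷ w) e = let i , e′ = ∧-true⁻ {Indᵇ b c} e in
    (Ind⇒≢ (Indᵇ-sound i) , Indᵇ-sound i) ∷ IndAllᵇ⁻ b w e′

  Cliqueᵇ-⇔ : ∀ w → IsClique A w ⇔ (Cliqueᵇ w ≡ true)
  Cliqueᵇ-⇔ w = mk⇔ (to w) (from w)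
    where
    to : ∀ w → IsClique A w → Cliqueᵇ w ≡ true
    to []      []        = refl
    to (b ∷ w) (bw ∷ cw) = ∧-true⁺ (IndAllᵇ⁺ b w bw) (to w cw)
    from : ∀ w → Cliqueᵇ w ≡ true → IsClique A w
    from []      e = []
    from (b ∷ w) e = let bw , cw = ∧-true⁻ {IndAllᵇ b w} e in IndAllᵇ⁻ b w bw ∷ from w cw

  nf-fuel : ℕ → Word A → Word A
  nf-fuel zero    w = []
  nf-fuel (suc f) w = Maybe.maybe′ (λ a → a ∷ nf-fuel f (delete a w)) [] (least (λ a → Minimalᵇ a w))

  nf-fuel-≈ : ∀ f w → length w ≡ f → w ≈ nf-fuel f w
  nf-fuel-≈ zero    []      e = ~-refl
  nf-fuel-≈ (suc f) w       e with least (λ a → Minimalᵇ a w) in eq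
  ... | just a = ~-trans (Minimalᵇ⇒≈∷delete a w m)
                   (≈-∷ a (nf-fuel-≈ f (delete a w)
                             (ℕₚ.suc-injective (trans (length-delete a w (Minimalᵇ⇒∈ᵇ a w m)) e))))
    where m = least-satisfies _ eq
  nf-fuel-≈ (suc f) (b ∷ w) e | nothing =
    ⊥-elim (true≢false (trans (sym (Minimalᵇ-head b w)) (least-nothing _ eq b)))

  nf-fuel-cong : ∀ f {u v} → length u ≡ f → u ≈ v → nf-fuel f u ≡ nf-fuel f v
  nf-fuel-cong zero    e p = refl
  nf-fuel-cong (suc f) {u} {v} e p
    rewrite least-cong {P = λ a → Minimalᵇ a u} {Q = λ a → Minimalᵇ a v} (λ a → Minimalᵇ-≈ a p)
    with least (λ a → Minimalᵇ a v) in eq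
  ... | nothing = refl
  ... | just a  = cong (a ∷_) (nf-fuel-cong f (ℕₚ.suc-injective (trans (length-delete a u (Minimalᵇ⇒∈ᵇ a u m)) e))
                                             (delete-≈ a p))
    where m = trans (Minimalᵇ-≈ a p) (least-satisfies _ eq)

  -- The lexicographically least word of the trace of w. It is kept opaque because unfolding it
  -- during conversion checking is very expensive.
  opaque
    nf : Word A → Word A
    nf w = nf-fuel (length w) w

    nf-[] : nf [] ≡ []
    nf-[] = refl

    nf-≈ : ∀ w → w ≈ nf w
    nf-≈ w = nf-fuel-≈ (length w) w refl

    nf-cong : ∀ {u v} → u ≈ v → nf u ≡ nf v
    nf-cong {u} {v} p rewrite ≈-length p = nf-fuel-cong (length v) (≈-length p) p

  nf-injective : ∀ {u v} → nf u ≡ nf v → u ≈ v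
  nf-injective {u} {v} e = ~-trans (nf-≈ u) (subst (_≈ v) (sym e) (~-sym (nf-≈ v)))

  length-nf : ∀ w → length (nf w) ≡ length w
  length-nf w = sym (≈-length (nf-≈ w))

  _≟_ : DecidableEquality (Word A)
  _≟_ = Listₚ.≡-dec Fin._≟_

  NFᵇ : Word A → Bool
  NFᵇ w = does (nf w ≟ w)

  NFCliqueᵇ : Word A → Bool
  NFCliqueᵇ c = NFᵇ c ∧ Cliqueᵇ c

  NFᵇ-sound : ∀ {w} → NFᵇ w ≡ true → nf w ≡ w
  NFᵇ-sound {w} e with nf w ≟ w
  ... | yes p = p

  NFᵇ-[] : NFᵇ [] ≡ true
  NFᵇ-[] = dec-true (nf [] ≟ []) nf-[]

  NFᵇ-nf : ∀ w → NFᵇ (nf w) ≡ true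
  NFᵇ-nf w = dec-true (nf (nf w) ≟ nf w) (nf-cong (~-sym (nf-≈ w)))

  nf-unique : ∀ {u v} → u ≈ v → NFᵇ v ≡ true → nf u ≡ v
  nf-unique p e = trans (nf-cong p) (NFᵇ-sound e)

module NormalFormCounts (A : IndepAlphabet) where
  open IndepAlphabet A
  open Traces A

  words : ℕ → List (Word A)
  words n = Enumeration.elems (words-enumeration s n)

  PairLength : ℕ → ℕ → Word A × Word A → Set
  PairLength k l p = length (proj₁ p) ≡ k × length (proj₂ p) ≡ l

  pairs-enumeration : ∀ k l → Enumeration (Productₚ.≡-dec _≟_ _≟_) (PairLength k l)
  pairs-enumeration k l = words-enumeration s k ×-enumeration words-enumeration s l

  pairs : ℕ → ℕ → List (Word A × Word A)
  pairs k l = Enumeration.elems (pairs-enumeration k l)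

  #Pairs : (Word A × Word A → Bool) → ℕ → ℕ → ℕ
  #Pairs P k l = ∑[ p ∈ pairs k l ] 𝟙 (P p)

  Concatᵇ : (Word A → Bool) → (Word A → Bool) → (Word A → Bool) → Word A × Word A → Bool
  Concatᵇ S T R (u , v) = (S u ∧ T v) ∧ R (u ++ v)

  Concatᵇ⁻ : ∀ {S T R u v} → Concatᵇ S T R (u , v) ≡ true → S u ≡ true × T v ≡ true × R (u ++ v) ≡ true
  Concatᵇ⁻ {S} {T} {R} {u} {v} e =
    let st , r = ∧-true⁻ {S u ∧ T v} e; s , t = ∧-true⁻ {S u} st in s , t , r

  Concatᵇ⁺ : ∀ {S T R u v} → S u ≡ true → T v ≡ true → R (u ++ v) ≡ true → Concatᵇ S T R (u , v) ≡ true
  Concatᵇ⁺ s t r = ∧-true⁺ (∧-true⁺ s t) r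

  #NF : (Word A → Bool) → ℕ → ℕ
  #NF P n = ∑[ w ∈ words n ] 𝟙 (NFᵇ w ∧ P w)

  ClassCount⇒#NF : ∀ (P : Word A → Set) (Pᵇ : Word A → Bool) → (∀ w → P w ⇔ (Pᵇ w ≡ true)) →
    (∀ {u v} → u ≈ v → Pᵇ u ≡ Pᵇ v) → ∀ {n k} → ClassCount A P n k → k ≡ #NF Pᵇ n
  ClassCount⇒#NF P Pᵇ P⇔ Pᵇ-≈ {n} {k} (L , length-L , L-in , L-distinct , L-covers) = begin
      k
    ≡⟨ trans (sym length-L) (sym (∑-one L)) ⟩
      ∑[ u ∈ L ] 1
    ≡⟨ ∑-cong-on L L-in (λ u (len-u , _) → sym (each-once (nf u) (trans (length-nf u) len-u))) ⟩
      ∑[ u ∈ L ] ∑[ w ∈ words n ] 𝟙 (does (w ≟ nf u))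
    ≡⟨ ∑-comm L (words n) _ ⟩
      ∑[ w ∈ words n ] ∑[ u ∈ L ] 𝟙 (does (w ≟ nf u))
    ≡⟨ ∑-cong-on (words n) (elems-in) normal-forms-hit ⟩
      #NF Pᵇ n ∎
    where
    open ≡-Reasoning
    open Enumeration (words-enumeration s n)

    normal-forms-hit : ∀ w → length w ≡ n → ∑[ u ∈ L ] 𝟙 (does (w ≟ nf u)) ≡ 𝟙 (NFᵇ w ∧ Pᵇ w)
    normal-forms-hit w len-w with NFᵇ w ∧ Pᵇ w in e
    ... | true  = count-unique (λ u → w ≟ nf u) (λ w≡u w≡v u≉v → u≉v (nf-injective (trans (sym w≡u) w≡v)))
                    L L-distinct
                    (Any.map (λ w≈u → trans (sym (NFᵇ-sound (proj₁ (∧-true⁻ e)))) (nf-cong w≈u))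
                             (L-covers w len-w (Equivalence.from (P⇔ w) (proj₂ (∧-true⁻ e)))))
    ... | false = ∑-zero-on L L-in λ u (_ , Pu) → cong 𝟙 (dec-false (w ≟ nf u) λ { refl →
                    true≢false (trans (sym (∧-true⁺ (NFᵇ-nf u) (trans (sym (Pᵇ-≈ (nf-≈ u)))
                                                                      (Equivalence.to (P⇔ u) Pu)))) e) })

  #Pairs-reverse : ∀ (R : Word A → Bool) → (∀ {u v} → u ≈ v → R u ≡ R v) → ∀ k l →
    #Pairs (Concatᵇ NFᵇ NFCliqueᵇ R) k l ≡ #Pairs (Concatᵇ NFCliqueᵇ NFᵇ (R ∘ reverse)) l k
  #Pairs-reverse R R-≈ k l =
    count-bijection (pairs-enumeration k l) (pairs-enumeration l k)
      (Concatᵇ NFᵇ NFCliqueᵇ R) (Concatᵇ NFCliqueᵇ NFᵇ (R ∘ reverse)) record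
      { to = swap-reverse ; from = swap-reverse ; to-in = to-in ; from-in = from-in
      ; from∘to = involutive ; to∘from = involutive′ }
    where
    rnf : Word A → Word A
    rnf w = nf (reverse w)

    swap-reverse : Word A × Word A → Word A × Word A
    swap-reverse (u , v) = rnf v , rnf u

    length-rnf : ∀ w → length (rnf w) ≡ length w
    length-rnf w = trans (length-nf (reverse w)) (Listₚ.length-reverse w)

    reverse-rnf : ∀ w → reverse (rnf w) ≈ w
    reverse-rnf w = subst (reverse (rnf w) ≈_) (Listₚ.reverse-involutive w) (≈-reverse (~-sym (nf-≈ (reverse w))))

    rnf-rnf : ∀ {w} → NFᵇ w ≡ true → rnf (rnf w) ≡ w
    rnf-rnf {w} = nf-unique (reverse-rnf w)

    NFCliqueᵇ-rnf : ∀ c → NFCliqueᵇ c ≡ true → NFCliqueᵇ (rnf c) ≡ true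
    NFCliqueᵇ-rnf c e = ∧-true⁺ (NFᵇ-nf (reverse c))
      (trans (sym (Cliqueᵇ-≈ (~-trans (Cliqueᵇ⇒≈reverse c clique) (nf-≈ (reverse c))))) clique)
      where clique = proj₂ (∧-true⁻ {NFᵇ c} e)

    to-in : ∀ {p} → PairLength k l p × Concatᵇ NFᵇ NFCliqueᵇ R p ≡ true →
            PairLength l k (swap-reverse p) × Concatᵇ NFCliqueᵇ NFᵇ (R ∘ reverse) (swap-reverse p) ≡ true
    to-in {x , c} ((len-x , len-c) , e) with Concatᵇ⁻ {NFᵇ} {NFCliqueᵇ} {R} e
    ... | x-nf , c-nfclique , r =
        (trans (length-rnf c) len-c , trans (length-rnf x) len-x)
      , Concatᵇ⁺ {NFCliqueᵇ} {NFᵇ} {R ∘ reverse} {rnf c} {rnf x} (NFCliqueᵇ-rnf c c-nfclique) (NFᵇ-nf (reverse x))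
          (trans (R-≈ (subst (_≈ x ++ c) (sym (Listₚ.reverse-++ (rnf c) (rnf x)))
                             (≈-++ (reverse-rnf x) (reverse-rnf c)))) r)

    from-in : ∀ {p} → PairLength l k p × Concatᵇ NFCliqueᵇ NFᵇ (R ∘ reverse) p ≡ true →
              PairLength k l (swap-reverse p) × Concatᵇ NFᵇ NFCliqueᵇ R (swap-reverse p) ≡ true
    from-in {c , x} ((len-c , len-x) , e) with Concatᵇ⁻ {NFCliqueᵇ} {NFᵇ} {R ∘ reverse} e
    ... | c-nfclique , x-nf , r =
        (trans (length-rnf x) len-x , trans (length-rnf c) len-c)
      , Concatᵇ⁺ {NFᵇ} {NFCliqueᵇ} {R} {rnf x} {rnf c} (NFᵇ-nf (reverse x)) (NFCliqueᵇ-rnf c c-nfclique)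
          (trans (R-≈ (subst (rnf x ++ rnf c ≈_) (sym (Listₚ.reverse-++ c x))
                             (≈-++ (~-sym (nf-≈ (reverse x))) (~-sym (nf-≈ (reverse c)))))) r)

    involutive : ∀ {p} → PairLength k l p × Concatᵇ NFᵇ NFCliqueᵇ R p ≡ true →
                 swap-reverse (swap-reverse p) ≡ p
    involutive {x , c} (_ , e) with Concatᵇ⁻ {NFᵇ} {NFCliqueᵇ} {R} e
    ... | x-nf , c-nfclique , _ = cong₂ _,_ (rnf-rnf x-nf) (rnf-rnf (proj₁ (∧-true⁻ {NFᵇ c} c-nfclique)))

    involutive′ : ∀ {p} → PairLength l k p × Concatᵇ NFCliqueᵇ NFᵇ (R ∘ reverse) p ≡ true →
                  swap-reverse (swap-reverse p) ≡ p
    involutive′ {c , x} (_ , e) with Concatᵇ⁻ {NFCliqueᵇ} {NFᵇ} {R ∘ reverse} e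
    ... | c-nfclique , x-nf , _ = cong₂ _,_ (rnf-rnf (proj₁ (∧-true⁻ {NFᵇ c} c-nfclique))) (rnf-rnf x-nf)

module SignReversingInvolution (A : IndepAlphabet) (R : Word A → Bool)
                               (R-≈ : ∀ {u v} → _~_ A u v → R u ≡ R v) where
  open IndepAlphabet A
  open Traces A
  open NormalFormCounts A

  Admissibleᵇ : Word A × Word A → Bool
  Admissibleᵇ = Concatᵇ NFCliqueᵇ NFᵇ R

  record Admissible (c x : Word A) : Set where
    field
      c-nf     : NFᵇ c ≡ true
      c-clique : Cliqueᵇ c ≡ true
      x-nf     : NFᵇ x ≡ true
      cx-R     : R (c ++ x) ≡ true

  Admissibleᵇ⁻ : ∀ {c x} → Admissibleᵇ (c , x) ≡ true → Admissible c x
  Admissibleᵇ⁻ {c} {x} e =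
    let c-nfclique , x-nf , r = Concatᵇ⁻ {NFCliqueᵇ} {NFᵇ} {R} e
        c-nf , c-clique       = ∧-true⁻ {NFᵇ c} c-nfclique
    in record { c-nf = c-nf ; c-clique = c-clique ; x-nf = x-nf ; cx-R = r }

  Admissibleᵇ⁺ : ∀ {c x} → Admissible c x → Admissibleᵇ (c , x) ≡ true
  Admissibleᵇ⁺ adm = Concatᵇ⁺ {NFCliqueᵇ} {NFᵇ} {R} (∧-true⁺ c-nf c-clique) x-nf cx-R
    where open Admissible adm

  Admissibleᵇ-∧⁻ : ∀ {c x d} → Admissibleᵇ (c , x) ∧ d ≡ true → Admissible c x × d ≡ true
  Admissibleᵇ-∧⁻ {c} {x} e = let adm , d = ∧-true⁻ {Admissibleᵇ (c , x)} e in Admissibleᵇ⁻ adm , d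

  -- b can be moved from the clique into the trace, or from the trace into the clique.
  Candidateᵇ : Word A → Word A → Letter A → Bool
  Candidateᵇ c x b = b ∈ᵇ c ∨ (Minimalᵇ b x ∧ IndAllᵇ b c)

  pivot : Word A → Word A → Maybe (Letter A)
  pivot c x = least (Candidateᵇ c x)

  pivot-nothing : ∀ c x → pivot c x ≡ nothing → c ≡ [] × x ≡ []
  pivot-nothing []      []      e = refl , refl
  pivot-nothing (b ∷ c) x       e =
    case trans (sym (∨-true⁺ˡ _ (∈ᵇ-head b c))) (least-nothing (Candidateᵇ (b ∷ c) x) e b) of λ ()
  pivot-nothing []      (b ∷ x) e =
    case trans (sym (cong (_∧ true) (Minimalᵇ-head b x))) (least-nothing (Candidateᵇ [] (b ∷ x)) e b) of λ ()

  PivotInCliqueᵇ : Word A × Word A → Bool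
  PivotInCliqueᵇ (c , x) = Maybe.maybe′ (_∈ᵇ c) false (pivot c x)

  PivotInCliqueᵇ-pivot : ∀ {c x a} → pivot c x ≡ just a → PivotInCliqueᵇ (c , x) ≡ a ∈ᵇ c
  PivotInCliqueᵇ-pivot {c} = cong (Maybe.maybe′ (_∈ᵇ c) false)

  lower : Word A × Word A → Word A × Word A
  lower (c , x) = Maybe.maybe′ (λ a → nf (delete a c) , nf (a ∷ x)) (c , x) (pivot c x)

  raise : Word A × Word A → Word A × Word A
  raise (c , x) = Maybe.maybe′ (λ a → nf (c ++ [ a ]) , nf (delete a x)) (c , x) (pivot c x)

  module Lower {c x a} (adm : Admissible c x) (piv : pivot c x ≡ just a) (a∈c : a ∈ᵇ c ≡ true) where
    open Admissible adm

    c′ x′ : Word A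
    c′ = nf (delete a c)
    x′ = nf (a ∷ x)

    c′≈ : c′ ≈ delete a c
    c′≈ = ~-sym (nf-≈ (delete a c))

    x′≈ : x′ ≈ a ∷ x
    x′≈ = ~-sym (nf-≈ (a ∷ x))

    c≈ : c ≈ a ∷ delete a c
    c≈ = Minimalᵇ⇒≈∷delete a c (Cliqueᵇ-Minimalᵇ a c c-clique a∈c)

    a-indep : IndAllᵇ a (delete a c) ≡ true
    a-indep = proj₁ (Cliqueᵇ-delete a c c-clique a∈c)

    c′∷ʳa≈c : c′ ++ [ a ] ≈ c
    c′∷ʳa≈c = ~-trans (≈-++ʳ [ a ] c′≈) (~-trans (IndAllᵇ⇒∷ʳ≈∷ a (delete a c) a-indep) (~-sym c≈))

    admissible : Admissible c′ x′
    admissible = record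
      { c-nf     = NFᵇ-nf (delete a c)
      ; c-clique = trans (Cliqueᵇ-≈ c′≈) (proj₂ (Cliqueᵇ-delete a c c-clique a∈c))
      ; x-nf     = NFᵇ-nf (a ∷ x)
      ; cx-R     = trans (R-≈ c′x′≈cx) cx-R
      }
      where
      c′x′≈cx : c′ ++ x′ ≈ c ++ x
      c′x′≈cx = ~-trans (≈-++ˡ c′ x′≈)
                  (subst (_≈ c ++ x) (Listₚ.++-assoc c′ [ a ] x) (≈-++ʳ x c′∷ʳa≈c))

    a∉c′ : a ∈ᵇ c′ ≡ false
    a∉c′ = trans (∈ᵇ-≈ a c′≈) (Cliqueᵇ-∉ᵇ-delete a c c-clique)

    length-c′ : suc (length c′) ≡ length c
    length-c′ = trans (cong suc (length-nf (delete a c))) (length-delete a c a∈c)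

    length-x′ : length x′ ≡ suc (length x)
    length-x′ = length-nf (a ∷ x)

    pivot′ : pivot c′ x′ ≡ just a
    pivot′ = least≡just (Candidateᵇ c′ x′) candidate below
      where
      candidate : Candidateᵇ c′ x′ a ≡ true
      candidate = ∨-true⁺ʳ (a ∈ᵇ c′) (∧-true⁺ (trans (Minimalᵇ-≈ a x′≈) (Minimalᵇ-head a x))
                                                (trans (IndAllᵇ-≈ a c′≈) a-indep))
      was-candidate : ∀ b → b ≢ a → Candidateᵇ c′ x′ b ≡ true → Candidateᵇ c x b ≡ true
      was-candidate b b≢a cand with ∨-true⁻ {b ∈ᵇ c′} cand
      ... | inj₁ b∈c′ = ∨-true⁺ˡ _ (∈ᵇ-delete⁻ a b c (trans (sym (∈ᵇ-≈ b c′≈)) b∈c′))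
      ... | inj₂ r    = ∨-true⁺ʳ (b ∈ᵇ c) (∧-true⁺ (proj₂ ba×b-min) b-indep)
        where
        ba×b-min : Indᵇ b a ≡ true × Minimalᵇ b x ≡ true
        ba×b-min = ∧-true⁻ (trans (sym (Minimalᵇ-≢ x b≢a))
                                  (trans (sym (Minimalᵇ-≈ b x′≈)) (proj₁ (∧-true⁻ r))))
        b-indep : IndAllᵇ b c ≡ true
        b-indep = trans (IndAllᵇ-≈ b c≈)
                        (∧-true⁺ (proj₁ ba×b-min) (trans (sym (IndAllᵇ-≈ b c′≈)) (proj₂ (∧-true⁻ r))))
      below : ∀ b → b Fin.< a → Candidateᵇ c′ x′ b ≡ false
      below b b<a = ¬-not λ cand → true≢false
        (trans (sym (was-candidate b (Finₚ.<⇒≢ b<a) cand)) (least-minimal _ piv b b<a))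

    raise-lower : raise (c′ , x′) ≡ (c , x)
    raise-lower rewrite pivot′ =
      cong₂ _,_ (nf-unique c′∷ʳa≈c c-nf)
                (nf-unique (subst (delete a x′ ≈_) (delete-head a x) (delete-≈ a x′≈)) x-nf)

  module Raise {c x a} (adm : Admissible c x) (piv : pivot c x ≡ just a) (a∉c : a ∈ᵇ c ≡ false) where
    open Admissible adm

    c′ x′ : Word A
    c′ = nf (c ++ [ a ])
    x′ = nf (delete a x)

    a-min×indep : Minimalᵇ a x ≡ true × IndAllᵇ a c ≡ true
    a-min×indep with ∨-true⁻ {a ∈ᵇ c} (least-satisfies _ piv)
    ... | inj₁ a∈c = case trans (sym a∈c) a∉c of λ ()
    ... | inj₂ r   = ∧-true⁻ r

    c′≈ : c′ ≈ a ∷ c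
    c′≈ = ~-trans (~-sym (nf-≈ (c ++ [ a ]))) (IndAllᵇ⇒∷ʳ≈∷ a c (proj₂ a-min×indep))

    x′≈ : x′ ≈ delete a x
    x′≈ = ~-sym (nf-≈ (delete a x))

    x≈ : x ≈ a ∷ delete a x
    x≈ = Minimalᵇ⇒≈∷delete a x (proj₁ a-min×indep)

    admissible : Admissible c′ x′
    admissible = record
      { c-nf     = NFᵇ-nf (c ++ [ a ])
      ; c-clique = trans (Cliqueᵇ-≈ c′≈) (∧-true⁺ (proj₂ a-min×indep) c-clique)
      ; x-nf     = NFᵇ-nf (delete a x)
      ; cx-R     = trans (R-≈ c′x′≈cx) cx-R
      }
      where
      c′x′≈cx : c′ ++ x′ ≈ c ++ x
      c′x′≈cx = ~-trans (≈-++ (~-sym (nf-≈ (c ++ [ a ]))) x′≈)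
                  (subst (_≈ c ++ x) (sym (Listₚ.++-assoc c [ a ] (delete a x))) (≈-++ˡ c (~-sym x≈)))

    a∈c′ : a ∈ᵇ c′ ≡ true
    a∈c′ = trans (∈ᵇ-≈ a c′≈) (∈ᵇ-head a c)

    length-c′ : length c′ ≡ suc (length c)
    length-c′ = ≈-length c′≈

    length-x′ : suc (length x′) ≡ length x
    length-x′ = trans (cong suc (length-nf (delete a x)))
                      (length-delete a x (Minimalᵇ⇒∈ᵇ a x (proj₁ a-min×indep)))

    pivot′ : pivot c′ x′ ≡ just a
    pivot′ = least≡just (Candidateᵇ c′ x′) (∨-true⁺ˡ _ a∈c′) below
      where
      was-candidate : ∀ b → b ≢ a → Candidateᵇ c′ x′ b ≡ true → Candidateᵇ c x b ≡ true
      was-candidate b b≢a cand with ∨-true⁻ {b ∈ᵇ c′} cand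
      ... | inj₁ b∈c′ = ∨-true⁺ˡ _ (trans (sym (∈ᵇ-≢ c b≢a)) (trans (sym (∈ᵇ-≈ b c′≈)) b∈c′))
      ... | inj₂ r    = ∨-true⁺ʳ (b ∈ᵇ c) (∧-true⁺ b-min (proj₂ ba×b-indep))
        where
        ba×b-indep : Indᵇ b a ≡ true × IndAllᵇ b c ≡ true
        ba×b-indep = ∧-true⁻ (trans (sym (IndAllᵇ-≈ b c′≈)) (proj₂ (∧-true⁻ r)))
        b-min : Minimalᵇ b x ≡ true
        b-min = trans (Minimalᵇ-≈ b x≈) (trans (Minimalᵇ-≢ (delete a x) b≢a)
                  (∧-true⁺ (proj₁ ba×b-indep) (trans (sym (Minimalᵇ-≈ b x′≈)) (proj₁ (∧-true⁻ r)))))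
      below : ∀ b → b Fin.< a → Candidateᵇ c′ x′ b ≡ false
      below b b<a = ¬-not λ cand → true≢false
        (trans (sym (was-candidate b (Finₚ.<⇒≢ b<a) cand)) (least-minimal _ piv b b<a))

    lower-raise : lower (c′ , x′) ≡ (c , x)
    lower-raise rewrite pivot′ =
      cong₂ _,_ (nf-unique (subst (delete a c′ ≈_) (delete-head a c) (delete-≈ a c′≈)) c-nf)
                (nf-unique (~-trans (≈-∷ a x′≈) (~-sym x≈)) x-nf)

  Lowerableᵇ Raisableᵇ : Word A × Word A → Bool
  Lowerableᵇ p = Admissibleᵇ p ∧ PivotInCliqueᵇ p
  Raisableᵇ  p = Admissibleᵇ p ∧ not (PivotInCliqueᵇ p)

  lower⇿raise : ∀ k l → (λ p → PairLength (suc k) l p × Lowerableᵇ p ≡ true)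
                      ⇿ (λ p → PairLength k (suc l) p × Raisableᵇ p ≡ true)
  lower⇿raise k l = record
    { to = lower ; from = raise ; to-in = lower-in ; from-in = raise-in
    ; from∘to = raise∘lower ; to∘from = lower∘raise }
    where
    lower-in : ∀ {p} → PairLength (suc k) l p × Lowerableᵇ p ≡ true →
               PairLength k (suc l) (lower p) × Raisableᵇ (lower p) ≡ true
    lower-in {c , x} ((len-c , len-x) , e) with pivot c x in piv
    ... | nothing = case proj₂ (Admissibleᵇ-∧⁻ e) of λ ()
    ... | just a  = (ℕₚ.suc-injective (trans length-c′ len-c) , trans length-x′ (cong suc len-x))
                  , ∧-true⁺ (Admissibleᵇ⁺ admissible)
                            (cong not (trans (PivotInCliqueᵇ-pivot {c′} {x′} pivot′) a∉c′))
      where open Lower {c} {x} {a} (proj₁ (Admissibleᵇ-∧⁻ e)) piv (proj₂ (Admissibleᵇ-∧⁻ e))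

    raise-in : ∀ {p} → PairLength k (suc l) p × Raisableᵇ p ≡ true →
               PairLength (suc k) l (raise p) × Lowerableᵇ (raise p) ≡ true
    raise-in {c , x} ((len-c , len-x) , e) with pivot c x in piv
    ... | nothing with pivot-nothing c x piv
    ...   | refl , refl = case len-x of λ ()
    raise-in {c , x} ((len-c , len-x) , e) | just a =
        (trans length-c′ (cong suc len-c) , ℕₚ.suc-injective (trans length-x′ len-x))
      , ∧-true⁺ (Admissibleᵇ⁺ admissible) (trans (PivotInCliqueᵇ-pivot {c′} {x′} pivot′) a∈c′)
      where open Raise {c} {x} {a} (proj₁ (Admissibleᵇ-∧⁻ e)) piv (not-injective (proj₂ (Admissibleᵇ-∧⁻ e)))

    raise∘lower : ∀ {p} → PairLength (suc k) l p × Lowerableᵇ p ≡ true → raise (lower p) ≡ p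
    raise∘lower {c , x} (_ , e) with pivot c x in piv
    ... | nothing = case proj₂ (Admissibleᵇ-∧⁻ e) of λ ()
    ... | just a  = raise-lower
      where open Lower {c} {x} {a} (proj₁ (Admissibleᵇ-∧⁻ e)) piv (proj₂ (Admissibleᵇ-∧⁻ e))

    lower∘raise : ∀ {p} → PairLength k (suc l) p × Raisableᵇ p ≡ true → lower (raise p) ≡ p
    lower∘raise {c , x} ((_ , len-x) , e) with pivot c x in piv
    ... | nothing with pivot-nothing c x piv
    ...   | refl , refl = case len-x of λ ()
    lower∘raise {c , x} (_ , e) | just a = lower-raise
      where open Raise {c} {x} {a} (proj₁ (Admissibleᵇ-∧⁻ e)) piv (not-injective (proj₂ (Admissibleᵇ-∧⁻ e)))

  #Lowerable≡#Raisable : ∀ k l → #Pairs Lowerableᵇ (suc k) l ≡ #Pairs Raisableᵇ k (suc l)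
  #Lowerable≡#Raisable k l =
    count-bijection (pairs-enumeration (suc k) l) (pairs-enumeration k (suc l)) Lowerableᵇ Raisableᵇ (lower⇿raise k l)

  #Lowerable-[] : ∀ l → #Pairs Lowerableᵇ 0 l ≡ 0
  #Lowerable-[] l = ∑-zero-on (pairs 0 l) (Enumeration.elems-in (pairs-enumeration 0 l)) empty-clique
    where
    empty-clique : ∀ p → PairLength 0 l p → 𝟙 (Lowerableᵇ p) ≡ 0
    empty-clique ([] , x) _ with pivot [] x
    ... | nothing = cong 𝟙 (∧-zeroʳ (Admissibleᵇ ([] , x)))
    ... | just _  = cong 𝟙 (∧-zeroʳ (Admissibleᵇ ([] , x)))

  #Raisable-[] : ∀ k → #Pairs Raisableᵇ (suc k) 0 ≡ 0
  #Raisable-[] k = ∑-zero-on (pairs (suc k) 0) (Enumeration.elems-in (pairs-enumeration (suc k) 0)) empty-trace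
    where
    empty-trace : ∀ p → PairLength (suc k) 0 p → 𝟙 (Raisableᵇ p) ≡ 0
    empty-trace (b ∷ c , []) _ with pivot (b ∷ c) [] in piv
    ... | nothing = case proj₁ (pivot-nothing (b ∷ c) [] piv) of λ ()
    ... | just a  = cong 𝟙 (trans (cong (λ d → Admissibleᵇ (b ∷ c , []) ∧ not d) a∈c) (∧-zeroʳ _))
      where
      a∈c : a ∈ᵇ (b ∷ c) ≡ true
      a∈c = trans (sym (∨-identityʳ _)) (least-satisfies (Candidateᵇ (b ∷ c) []) piv)

  #Admissible≡#Lowerable+#Raisable : ∀ k l → #Pairs Admissibleᵇ k l ≡ #Pairs Lowerableᵇ k l + #Pairs Raisableᵇ k l
  #Admissible≡#Lowerable+#Raisable k l =
    trans (∑-cong (pairs k l) (λ p → split (Admissibleᵇ p) (PivotInCliqueᵇ p))) (∑-+ (pairs k l) _ _)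
    where
    split : ∀ g d → 𝟙 g ≡ 𝟙 (g ∧ d) + 𝟙 (g ∧ not d)
    split true  true  = refl
    split true  false = refl
    split false d     = refl

  alternating-#Admissible : ∀ n → sumUpTo (suc n) (λ k → sign k ℤ.* ℤ.+ #Pairs Admissibleᵇ k (suc n ∸ k)) ≡ ℤ.0ℤ
  alternating-#Admissible n = begin
      sumUpTo (suc n) (λ k → sign k ℤ.* ℤ.+ #Pairs Admissibleᵇ k (suc n ∸ k))
    ≡⟨ sumUpTo-cong (suc n) (λ k _ →
         cong (λ a → sign k ℤ.* ℤ.+ a) (#Admissible≡#Lowerable+#Raisable k (suc n ∸ k))) ⟩
      sumUpTo (suc n) (λ k → sign k ℤ.* ℤ.+ (B k + C k))
    ≡⟨ sumUpTo-alternating-telescope (suc n) B C (#Lowerable-[] (suc n)) B≡C ⟩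
      sign (suc n) ℤ.* ℤ.+ C (suc n)
    ≡⟨ cong (λ a → sign (suc n) ℤ.* ℤ.+ a) C-last ⟩
      sign (suc n) ℤ.* ℤ.0ℤ
    ≡⟨ ℤₚ.*-zeroʳ (sign (suc n)) ⟩
      ℤ.0ℤ ∎
    where
    open ≡-Reasoning
    B C : ℕ → ℕ
    B k = #Pairs Lowerableᵇ k (suc n ∸ k)
    C k = #Pairs Raisableᵇ  k (suc n ∸ k)
    B≡C : ∀ k → k < suc n → B (suc k) ≡ C k
    B≡C k (s≤s k≤n) = trans (#Lowerable≡#Raisable k (n ∸ k))
                            (cong (#Pairs Raisableᵇ k) (sym (ℕₚ.+-∸-assoc 1 k≤n)))
    C-last : C (suc n) ≡ 0
    C-last = trans (cong (#Pairs Raisableᵇ (suc n)) (ℕₚ.n∸n≡0 n)) (#Raisable-[] n)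

module Action (A : IndepAlphabet) (m : ℕ) (act : PartialAction A m) where
  open IndepAlphabet A
  open PartialAction act
  open Traces A
  open NormalFormCounts A

  stepT-swap : ∀ t {a b} → Ind a b → stepT (stepT t a) b ≡ stepT (stepT t b) a
  stepT-swap nothing         i = refl
  stepT-swap (just α) {a} {b} i with step α a in αa
  ... | just α′ with coherent α a b α′ αa (Ind⇒≢ i , i)
  ...   | inj₁ (_ , _ , αb , α′b , βa) rewrite αb | α′b | βa = refl
  ...   | inj₂ (αb , α′b)              rewrite αb | α′b = refl
  stepT-swap (just α) {a} {b} i | nothing with step α b in αb
  ...   | nothing = refl
  ...   | just β with coherent α b a β αb (Ind⇒≢ (Ind-sym a b i) , Ind-sym a b i)
  ...     | inj₁ (_ , _ , αa′ , _ , _) = case trans (sym αa′) αa of λ ()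
  ...     | inj₂ (_ , βa)              = sym βa

  actT-≈ : ∀ t {u v} → u ≈ v → actT t u ≡ actT t v
  actT-≈ t = ≈-invariant (actT t) λ u v {a} {b} i → begin
      actT t (u ++ a ∷ b ∷ v)                     ≡⟨ Listₚ.foldl-++ stepT t u (a ∷ b ∷ v) ⟩
      foldl stepT (stepT (stepT (actT t u) a) b) v ≡⟨ cong (λ t′ → foldl stepT t′ v) (stepT-swap (actT t u) i) ⟩
      foldl stepT (stepT (stepT (actT t u) b) a) v ≡⟨ sym (Listₚ.foldl-++ stepT t u (b ∷ a ∷ v)) ⟩
      actT t (u ++ b ∷ a ∷ v)                     ∎
    where open ≡-Reasoning

  actT-⊥ : ∀ w → actT nothing w ≡ nothing
  actT-⊥ []      = refl
  actT-⊥ (a ∷ w) = actT-⊥ w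

  _≟ₘ_ : DecidableEquality (Maybe (Fin m))
  _≟ₘ_ = Maybeₚ.≡-dec Fin._≟_

  Reachesᵇ : Fin m → Fin m → Word A → Bool
  Reachesᵇ α β w = does (actT (just α) w ≟ₘ just β)

  Reachesᵇ-≈ : ∀ α β {u v} → u ≈ v → Reachesᵇ α β u ≡ Reachesᵇ α β v
  Reachesᵇ-≈ α β p = cong (λ t → does (t ≟ₘ just β)) (actT-≈ (just α) p)

  Reachesᵇ-⇔ : ∀ α β w → (actT (just α) w ≡ just β) ⇔ (Reachesᵇ α β w ≡ true)
  Reachesᵇ-⇔ α β w = mk⇔ (dec-true (actT (just α) w ≟ₘ just β)) sound
    where
    sound : Reachesᵇ α β w ≡ true → actT (just α) w ≡ just β
    sound e with actT (just α) w ≟ₘ just β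
    ... | yes r = r

  ∑-through-state : ∀ t x β → ∑[ γ ∈ allFin m ] (𝟙 (does (t ≟ₘ just γ)) * 𝟙 (Reachesᵇ γ β x))
                    ≡ 𝟙 (does (actT t x ≟ₘ just β))
  ∑-through-state nothing  x β rewrite actT-⊥ x = ∑-zero (allFin m)
  ∑-through-state (just δ) x β = begin
      ∑[ γ ∈ allFin m ] (𝟙 (does (just δ ≟ₘ just γ)) * 𝟙 (Reachesᵇ γ β x))
    ≡⟨ ∑-cong (allFin m) only-δ ⟩
      ∑[ γ ∈ allFin m ] (𝟙 (does (γ Fin.≟ δ)) * 𝟙 (Reachesᵇ δ β x))
    ≡⟨ ∑-*ʳ (allFin m) _ _ ⟩
      ∑[ γ ∈ allFin m ] 𝟙 (does (γ Fin.≟ δ)) * 𝟙 (Reachesᵇ δ β x)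
    ≡⟨ cong (_* 𝟙 (Reachesᵇ δ β x)) (Enumeration.each-once (allFin-enumeration m) δ δ) ⟩
      𝟙 (Reachesᵇ δ β x) + 0
    ≡⟨ ℕₚ.+-identityʳ _ ⟩
      𝟙 (Reachesᵇ δ β x) ∎
    where
    open ≡-Reasoning
    only-δ : ∀ γ → 𝟙 (does (just δ ≟ₘ just γ)) * 𝟙 (Reachesᵇ γ β x)
                 ≡ 𝟙 (does (γ Fin.≟ δ)) * 𝟙 (Reachesᵇ δ β x)
    only-δ γ with γ Fin.≟ δ
    ... | yes refl = cong (λ b → 𝟙 b * 𝟙 (Reachesᵇ γ β x)) (dec-true (just γ ≟ₘ just γ) refl)
    ... | no γ≢δ   = cong (λ b → 𝟙 b * 𝟙 (Reachesᵇ γ β x))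
                          (dec-false (just δ ≟ₘ just γ) (γ≢δ ∘ sym ∘ Maybeₚ.just-injective))

  #Reach : (Word A → Bool) → Fin m → Fin m → ℕ → ℕ
  #Reach S α β n = ∑[ w ∈ words n ] 𝟙 (S w ∧ Reachesᵇ α β w)

  ∑-#Reach-* : ∀ (S T : Word A → Bool) α β k l →
    ∑[ γ ∈ allFin m ] (#Reach S α γ k * #Reach T γ β l) ≡ #Pairs (Concatᵇ S T (Reachesᵇ α β)) k l
  ∑-#Reach-* S T α β k l = begin
      ∑[ γ ∈ allFin m ] (#Reach S α γ k * #Reach T γ β l)
    ≡⟨ ∑-cong (allFin m) (λ γ → ∑-*-∑ (words k) (words l) _ _) ⟩
      ∑[ γ ∈ allFin m ] ∑[ u ∈ words k ] ∑[ v ∈ words l ] term u v γ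
    ≡⟨ ∑-comm (allFin m) (words k) _ ⟩
      ∑[ u ∈ words k ] ∑[ γ ∈ allFin m ] ∑[ v ∈ words l ] term u v γ
    ≡⟨ ∑-cong (words k) (λ u → ∑-comm (allFin m) (words l) _) ⟩
      ∑[ u ∈ words k ] ∑[ v ∈ words l ] ∑[ γ ∈ allFin m ] term u v γ
    ≡⟨ ∑-cong (words k) (λ u → ∑-cong (words l) (λ v → through-γ u v)) ⟩
      ∑[ u ∈ words k ] ∑[ v ∈ words l ] 𝟙 (Concatᵇ S T (Reachesᵇ α β) (u , v))
    ≡⟨ sym (∑-cartesianProductWith _,_ (words k) (words l) _) ⟩
      #Pairs (Concatᵇ S T (Reachesᵇ α β)) k l ∎
    where
    open ≡-Reasoning
    term : Word A → Word A → Fin m → ℕ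
    term u v γ = 𝟙 (S u ∧ Reachesᵇ α γ u) * 𝟙 (T v ∧ Reachesᵇ γ β v)

    through-γ : ∀ u v → ∑[ γ ∈ allFin m ] term u v γ ≡ 𝟙 (Concatᵇ S T (Reachesᵇ α β) (u , v))
    through-γ u v = begin
        ∑[ γ ∈ allFin m ] term u v γ
      ≡⟨ ∑-cong (allFin m) (λ γ → trans (cong₂ _*_ (𝟙-∧ (S u) _) (𝟙-∧ (T v) _))
                                         (*-interchange (𝟙 (S u)) _ (𝟙 (T v)) _)) ⟩
        ∑[ γ ∈ allFin m ] (𝟙 (S u) * 𝟙 (T v) * (𝟙 (Reachesᵇ α γ u) * 𝟙 (Reachesᵇ γ β v)))
      ≡⟨ ∑-*ˡ (allFin m) (𝟙 (S u) * 𝟙 (T v)) _ ⟩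
        𝟙 (S u) * 𝟙 (T v) * ∑[ γ ∈ allFin m ] (𝟙 (Reachesᵇ α γ u) * 𝟙 (Reachesᵇ γ β v))
      ≡⟨ cong (𝟙 (S u) * 𝟙 (T v) *_) (∑-through-state (actT (just α) u) v β) ⟩
        𝟙 (S u) * 𝟙 (T v) * 𝟙 (does (actT (actT (just α) u) v ≟ₘ just β))
      ≡⟨ cong (λ t → 𝟙 (S u) * 𝟙 (T v) * 𝟙 (does (t ≟ₘ just β))) (sym (Listₚ.foldl-++ stepT (just α) u v)) ⟩
        𝟙 (S u) * 𝟙 (T v) * 𝟙 (Reachesᵇ α β (u ++ v))
      ≡⟨ sym (trans (𝟙-∧ (S u ∧ T v) _) (cong (_* 𝟙 (Reachesᵇ α β (u ++ v))) (𝟙-∧ (S u) (T v)))) ⟩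
        𝟙 (Concatᵇ S T (Reachesᵇ α β) (u , v)) ∎

  #Z #μ : Fin m → Fin m → ℕ → ℕ
  #Z = #Reach NFᵇ
  #μ = #Reach NFCliqueᵇ

  Counts-Z : PSMat m → Set
  Counts-Z Z = ∀ α β n → Σ ℕ λ k → ClassCount A (λ w → actT (just α) w ≡ just β) n k × Z α β n ≡ ℤ.+ k

  Counts-μ : PSMat m → Set
  Counts-μ μ = ∀ α β n → Σ ℕ λ k → ClassCount A (λ w → IsClique A w × actT (just α) w ≡ just β) n k
                                 × μ α β n ≡ sign n ℤ.* ℤ.+ k

  Z-coefficient : ∀ {Z} → Counts-Z Z → ∀ α β n → Z α β n ≡ ℤ.+ #Z α β n
  Z-coefficient hZ α β n with hZ α β n
  ... | k , count , Z≡k =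
    trans Z≡k (cong ℤ.+_ (ClassCount⇒#NF _ (Reachesᵇ α β) (Reachesᵇ-⇔ α β) (Reachesᵇ-≈ α β) count))

  μ-coefficient : ∀ {μ} → Counts-μ μ → ∀ α β n → μ α β n ≡ sign n ℤ.* ℤ.+ #μ α β n
  μ-coefficient hμ α β n with hμ α β n
  ... | k , count , μ≡k = trans μ≡k (cong (λ a → sign n ℤ.* ℤ.+ a) (trans k≡#NF (∑-cong (words n) reassoc)))
    where
    Pᵇ : Word A → Bool
    Pᵇ w = Cliqueᵇ w ∧ Reachesᵇ α β w
    P⇔Pᵇ : ∀ w → (IsClique A w × actT (just α) w ≡ just β) ⇔ (Pᵇ w ≡ true)
    P⇔Pᵇ w = mk⇔ (λ (c , r) → ∧-true⁺ (Equivalence.to (Cliqueᵇ-⇔ w) c) (Equivalence.to (Reachesᵇ-⇔ α β w) r))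
                 (λ e → let c , r = ∧-true⁻ {Cliqueᵇ w} e in
                        Equivalence.from (Cliqueᵇ-⇔ w) c , Equivalence.from (Reachesᵇ-⇔ α β w) r)
    k≡#NF : k ≡ #NF Pᵇ n
    k≡#NF = ClassCount⇒#NF _ Pᵇ P⇔Pᵇ (λ p → cong₂ _∧_ (Cliqueᵇ-≈ p) (Reachesᵇ-≈ α β p)) count
    reassoc : ∀ w → 𝟙 (NFᵇ w ∧ Pᵇ w) ≡ 𝟙 (NFCliqueᵇ w ∧ Reachesᵇ α β w)
    reassoc w = cong 𝟙 (sym (∧-assoc (NFᵇ w) (Cliqueᵇ w) _))

  Reachesᵇ-[] : ∀ α β → ℤ.+ 𝟙 (Reachesᵇ α β []) ≡ idPS α β 0
  Reachesᵇ-[] α β with α Fin.≟ β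
  ... | yes _ = refl
  ... | no _  = refl

  alternating≡idPS : ∀ α β (R : Word A → Bool) (R-≈ : ∀ {u v} → u ≈ v → R u ≡ R v) →
    R [] ≡ Reachesᵇ α β [] →
    let open SignReversingInvolution A R R-≈ in
    ∀ n → sumUpTo n (λ k → sign k ℤ.* ℤ.+ #Pairs Admissibleᵇ k (n ∸ k)) ≡ idPS α β n
  alternating≡idPS α β R R-≈ R-[] zero rewrite NFᵇ-[] | R-[] =
    trans (ℤₚ.*-identityˡ _) (trans (cong ℤ.+_ (ℕₚ.+-identityʳ _)) (Reachesᵇ-[] α β))
  alternating≡idPS α β R R-≈ R-[] (suc n) = alternating-#Admissible n
    where open SignReversingInvolution A R R-≈

  μ⊛Z≡idPS : ∀ {Z μ} → Counts-Z Z → Counts-μ μ → ∀ α β n → (μ ⊛ Z) α β n ≡ idPS α β n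
  μ⊛Z≡idPS {Z} {μ} hZ hμ α β n = begin
      sumFin m (λ γ → sumUpTo n (λ k → μ α γ k ℤ.* Z γ β (n ∸ k)))
    ≡⟨ sumFin-cong m (λ γ → sumUpTo-cong n (λ k _ →
         trans (cong₂ ℤ._*_ (μ-coefficient hμ α γ k) (Z-coefficient hZ γ β (n ∸ k)))
               (*-signedˡ (sign k) (#μ α γ k) (#Z γ β (n ∸ k))))) ⟩
      sumFin m (λ γ → sumUpTo n (λ k → sign k ℤ.* ℤ.+ (#μ α γ k * #Z γ β (n ∸ k))))
    ≡⟨ sumFin-sumUpTo-signed m n sign _ ⟩
      sumUpTo n (λ k → sign k ℤ.* ℤ.+ ∑[ γ ∈ allFin m ] (#μ α γ k * #Z γ β (n ∸ k)))
    ≡⟨ sumUpTo-cong n (λ k _ → cong (λ a → sign k ℤ.* ℤ.+ a) (∑-#Reach-* NFCliqueᵇ NFᵇ α β k (n ∸ k))) ⟩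
      sumUpTo n (λ k → sign k ℤ.* ℤ.+ #Pairs (Concatᵇ NFCliqueᵇ NFᵇ (Reachesᵇ α β)) k (n ∸ k))
    ≡⟨ alternating≡idPS α β (Reachesᵇ α β) (Reachesᵇ-≈ α β) refl n ⟩
      idPS α β n ∎
    where open ≡-Reasoning

  Z⊛μ≡idPS : ∀ {Z μ} → Counts-Z Z → Counts-μ μ → ∀ α β n → (Z ⊛ μ) α β n ≡ idPS α β n
  Z⊛μ≡idPS {Z} {μ} hZ hμ α β n = begin
      sumFin m (λ γ → sumUpTo n (λ k → Z α γ k ℤ.* μ γ β (n ∸ k)))
    ≡⟨ sumFin-cong m (λ γ → sumUpTo-cong n (λ k _ →
         trans (cong₂ ℤ._*_ (Z-coefficient hZ α γ k) (μ-coefficient hμ γ β (n ∸ k)))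
               (*-signedʳ (sign (n ∸ k)) (#Z α γ k) (#μ γ β (n ∸ k))))) ⟩
      sumFin m (λ γ → sumUpTo n (λ k → sign (n ∸ k) ℤ.* ℤ.+ (#Z α γ k * #μ γ β (n ∸ k))))
    ≡⟨ sumFin-sumUpTo-signed m n (λ k → sign (n ∸ k)) _ ⟩
      sumUpTo n (λ k → sign (n ∸ k) ℤ.* ℤ.+ ∑[ γ ∈ allFin m ] (#Z α γ k * #μ γ β (n ∸ k)))
    ≡⟨ sumUpTo-cong n (λ k k≤n → cong (λ a → sign (n ∸ k) ℤ.* ℤ.+ a)
         (trans (∑-#Reach-* NFᵇ NFCliqueᵇ α β k (n ∸ k))
         (trans (#Pairs-reverse (Reachesᵇ α β) (Reachesᵇ-≈ α β) k (n ∸ k))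
                (cong (#Pairs Admissibleᵇ (n ∸ k)) (sym (ℕₚ.m∸[m∸n]≡n k≤n)))))) ⟩
      sumUpTo n (λ k → sign (n ∸ k) ℤ.* ℤ.+ #Pairs Admissibleᵇ (n ∸ k) (n ∸ (n ∸ k)))
    ≡⟨ sumUpTo-reflect n (λ j → sign j ℤ.* ℤ.+ #Pairs Admissibleᵇ j (n ∸ j)) ⟩
      sumUpTo n (λ j → sign j ℤ.* ℤ.+ #Pairs Admissibleᵇ j (n ∸ j))
    ≡⟨ alternating≡idPS α β (Reachesᵇ α β ∘ reverse) (Reachesᵇ-≈ α β ∘ ≈-reverse) refl n ⟩
      idPS α β n ∎
    where
    open ≡-Reasoning
    open SignReversingInvolution A (Reachesᵇ α β ∘ reverse) (Reachesᵇ-≈ α β ∘ ≈-reverse)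

theorem4 : (A : IndepAlphabet) (m : ℕ) (act : PartialAction A m)
    (Z μ : PSMat m) →
    (∀ α β n → Σ ℕ λ k → ClassCount A (λ w → PartialAction.actT act (just α) w ≡ just β) n k
         × Z α β n ≡ ℤ.+ k) →
    (∀ α β n → Σ ℕ λ k → ClassCount A (λ w → IsClique A w × PartialAction.actT act (just α) w ≡ just β) n k
         × μ α β n ≡ sign n ℤ.* ℤ.+ k) →
    (∀ α β n → (μ ⊛ Z) α β n ≡ idPS α β n) × (∀ α β n → (Z ⊛ μ) α β n ≡ idPS α β n)
theorem4 A m act Z μ hZ hμ = μ⊛Z≡idPS hZ hμ , Z⊛μ≡idPS hZ hμ
  where open Action A m act
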